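{- Let $n\ge1$, $A\in\mathrm{Int}(n)$ and $x=\Gamma(A)=(x_1,\dots,x_n)$. Then: (1) $A_{1,1}$ equals the length of the run of $x$ containing $x_1$ (the starting $0$-run); (2) $\mathrm{val}(A)$ equals the length of the run of $x$ containing $x_n$ (the ending $x_n$-run); (3) $A_{\dim(A),\dim(A)}$ equals the length of the last run $(x_i,\dots,x_{i+j})$ of $x$ whose first entry satisfies $x_i=1+\mathrm{asc}_{i-1}(x)$, where by convention the first run (the one with $i=1$) qualifies. Furthermore, for each $n$, the three statistics $A\mapsto A_{1,1}$, $A\mapsto\mathrm{val}(A)$, $A\mapsto A_{\dim(A),\dim(A)}$ have the same distribution on $\mathrm{Int}(n)$, and the three corresponding statistics on ascent sequences in (1)–(3) have the same distribution on $\mathrm{Asc}(n)$.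
   Context: $\mathrm{Int}(n)$ is the set of upper triangular square matrices with non-negative integer entries summing to $n$ such that every row and column has a non-zero entry. For such $A$: $\dim(A)$ is the number of rows, $\mathrm{index}(A)$ the smallest $i$ with $A_{i,\dim(A)}>0$, $\mathrm{val}(A)=A_{\mathrm{index}(A),\dim(A)}$. For a sequence $y$, $\mathrm{asc}(y)$ is the number of $i$ with $y_i<y_{i+1}$, and $\mathrm{asc}_k(y)=\mathrm{asc}(y_1,\dots,y_k)$. $\mathrm{Asc}(n)$ is the set of integer sequences $(x_1,\dots,x_n)$ with $x_1=0$ and $x_i\in[0,1+\mathrm{asc}(x_1,\dots,x_{i-1})]$ for $1<i\le n$. A run of $x$ is a maximal block $(x_i,x_{i+1},\dots,x_{i+j})$ of consecutive equal entries (so $x_{i-1}\ne x_i$ if $i>1$ and $x_{i+j}\ne x_{i+j+1}$ if $i+j<n$); its length is $j+1$. Removal operation $f$ on $A\in\mathrm{Int}(n)$, $n\ge2$: (Rem1) if $\mathrm{val}(A)>1$, or if $\mathrm{val}(A)=1$, $\mathrm{index}(A)<\dim(A)$ and row $\mathrm{index}(A)$ has another positive entry, decrease entry $(\mathrm{index}(A),\dim(A))$ by $1$; (Rem2) if $\mathrm{val}(A)=1$ and $\mathrm{index}(A)=\dim(A)$, delete last row and column; (Rem3) if $\mathrm{val}(A)=1$, $\mathrm{index}(A)<\dim(A)$ and all other entries of row $\mathrm{index}(A)$ are $0$, set $A_{i,\dim(A)}:=A_{i,\mathrm{index}(A)}$ for $1\le i\le\mathrm{index}(A)-1$, then delete row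 and column $\mathrm{index}(A)$. $\Gamma:\mathrm{Int}(n)\to\mathrm{Asc}(n)$ (a bijection): $\Gamma((1))=(0)$ and for $n\ge2$, $\Gamma(A)$ is $\Gamma(f(A))$ with $\mathrm{index}(A)-1$ appended. -}

module Defs where

open import Data.Nat.Base using (ℕ; zero; suc; _+_; pred; _≡ᵇ_; _<ᵇ_; _≤ᵇ_)
open import Data.Bool.Base using (Bool; true; false; _∧_; _∨_; not; if_then_else_; T)
open import Data.Fin.Base using (Fin; toℕ; fromℕ; inject₁; punchIn)
open import Data.Fin.Properties using (_≟_)
open import Data.Vec.Base as Vec using (Vec; tabulate)
open import Data.List.Base as List using (List; []; _∷_; _++_; length; take; allFin)
open import Data.Bool.ListAction using (all; any)
open import Data.Maybe.Base using (Maybe; just; nothing; fromMaybe)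
open import Data.Product.Base using (Σ; _×_; _,_; proj₁; proj₂)
open import Relation.Nullary.Decidable.Core using (does)
open import Relation.Binary.PropositionalEquality using (_≡_)

-- Square matrices of natural numbers (0-based indices; paper's row i is Fin (i-1))

Matrix : ℕ → Set
Matrix d = Vec (Vec ℕ d) d

entry : ∀ {d} → Matrix d → Fin d → Fin d → ℕ
entry A i j = Vec.lookup (Vec.lookup A i) j

sumM : ∀ {d} → Matrix d → ℕ
sumM A = Vec.sum (Vec.map Vec.sum A)

allF : (k : ℕ) → (Fin k → Bool) → Bool
allF k p = all p (allFin k)

anyF : (k : ℕ) → (Fin k → Bool) → Bool
anyF k p = any p (allFin k)

isInt : ∀ {d} → ℕ → Matrix d → Bool
isInt {d} n A =
  (sumM A ≡ᵇ n)
  ∧ allF d (λ i → allF d (λ j → not (toℕ j <ᵇ toℕ i) ∨ (entry A i j ≡ᵇ 0)))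
  ∧ allF d (λ i → anyF d (λ j → 0 <ᵇ entry A i j))
  ∧ allF d (λ j → anyF d (λ i → 0 <ᵇ entry A i j))

-- The set Int(n); dimension is written suc m (a dimension-0 matrix has sum 0,
-- so it never lies in Int(n) for n ≥ 1).
Int : ℕ → Set
Int n = Σ ℕ λ m → Σ (Matrix (suc m)) λ A → T (isInt n A)

findFirst : ∀ {k} → (Fin k → ℕ) → Maybe (Fin k)
findFirst {zero} v = nothing
findFirst {suc k} v with v Fin.zero
... | zero  = Data.Maybe.Base.map Fin.suc (findFirst (λ i → v (Fin.suc i)))
  where import Data.Maybe.Base
... | suc _ = just Fin.zero

lastIx : ∀ m → Fin (suc m)
lastIx m = fromℕ m

-- index(A) (0-based, i.e. the paper's index(A) - 1)
index : ∀ {m} → Matrix (suc m) → Fin (suc m)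
index {m} A = fromMaybe (lastIx m) (findFirst (λ i → entry A i (lastIx m)))

val : ∀ {m} → Matrix (suc m) → ℕ
val {m} A = entry A (index A) (lastIx m)

eqF : ∀ {k} → Fin k → Fin k → Bool
eqF a b = does (a ≟ b)

rem1 : ∀ {m} → Matrix (suc m) → Matrix (suc m)
rem1 {m} A = tabulate λ r → tabulate λ c →
  if eqF r (index A) ∧ eqF c (lastIx m) then pred (entry A r c) else entry A r c

rem2 : ∀ {m} → Matrix (suc m) → Matrix m
rem2 A = tabulate λ r → tabulate λ c → entry A (inject₁ r) (inject₁ c)

-- Rem3: copy column index(A) into the last column above row index(A),
-- then delete row and column index(A)
rem3 : ∀ {m} → Matrix (suc m) → Matrix m
rem3 {m} A = tabulate λ r → tabulate λ c → A' (punchIn i r) (punchIn i c)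
  where
  i = index A
  A' : Fin (suc m) → Fin (suc m) → ℕ
  A' r c = if eqF c (lastIx m) ∧ (toℕ r <ᵇ toℕ i) then entry A r i else entry A r c

otherPos : ∀ {m} → Matrix (suc m) → Bool
otherPos {m} A = anyF m (λ k → 0 <ᵇ entry A (index A) (inject₁ k))

f : ∀ {m} → Matrix (suc m) → Σ ℕ Matrix
f {m} A =
  if (1 <ᵇ val A) ∨ ((val A ≡ᵇ 1) ∧ (toℕ (index A) <ᵇ m) ∧ otherPos A)
  then (suc m , rem1 A)
  else if (val A ≡ᵇ 1) ∧ (toℕ (index A) ≡ᵇ m)
  then (m , rem2 A)
  else (m , rem3 A)

-- Γ : Int(n) → Asc(n), recursion on n (the entry sum, used as fuel)

Γ' : ℕ → (d : ℕ) → Matrix d → List ℕ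
Γ' zero d A = []
Γ' (suc zero) d A = 0 ∷ []
Γ' (suc (suc k)) zero A = []
Γ' (suc (suc k)) (suc m) A = Γ' (suc k) (proj₁ (f A)) (proj₂ (f A)) ++ (toℕ (index A) ∷ [])

Γ : ∀ {m} → ℕ → Matrix (suc m) → List ℕ
Γ {m} n A = Γ' n (suc m) A

asc : List ℕ → ℕ
asc (a ∷ b ∷ ys) = (if a <ᵇ b then 1 else 0) + asc (b ∷ ys)
asc _ = 0

-- x ∈ Asc(n): length n, x₁ = 0, x_i ≤ 1 + asc(x₁,…,x_{i-1}) for i > 1
-- (position i is the 0-based Fin index i-1; take (i-1) x = (x₁,…,x_{i-1}))
isAsc : ℕ → List ℕ → Bool
isAsc n x =
  (length x ≡ᵇ n)
  ∧ all (λ i → ((toℕ i ≡ᵇ 0) ∧ (List.lookup x i ≡ᵇ 0))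
             ∨ ((0 <ᵇ toℕ i) ∧ (List.lookup x i ≤ᵇ suc (asc (take (toℕ i) x)))))
        (allFin (length x))

AscSet : ℕ → Set
AscSet n = Σ (List ℕ) λ x → T (isAsc n x)

-- Runs: list of (start position (0-based), value, length), in order

runs : List ℕ → List (ℕ × ℕ)           -- (value , length)
runs [] = []
runs (a ∷ xs) with runs xs
... | [] = (a , 1) ∷ []
... | (b , k) ∷ rs = if a ≡ᵇ b then (b , suc k) ∷ rs else (a , 1) ∷ (b , k) ∷ rs

addPos : ℕ → List (ℕ × ℕ) → List (ℕ × ℕ × ℕ)
addPos s [] = []
addPos s ((v , l) ∷ rs) = (s , v , l) ∷ addPos (s + l) rs

runsPos : List ℕ → List (ℕ × ℕ × ℕ)
runsPos x = addPos 0 (runs x)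

firstRunLen : List ℕ → ℕ
firstRunLen x with runs x
... | [] = 0
... | (v , l) ∷ _ = l

lastLen : List (ℕ × ℕ) → ℕ
lastLen [] = 0
lastLen ((v , l) ∷ []) = l
lastLen (_ ∷ r ∷ rs) = lastLen (r ∷ rs)

lastRunLen : List ℕ → ℕ
lastRunLen x = lastLen (runs x)

-- (3) length of the last run (x_i,…,x_{i+j}) with x_i = 1 + asc_{i-1}(x),
-- the first run (i = 1) qualifying by convention.  With 0-based start s = i-1,
-- asc_{i-1}(x) = asc (take s x).
qualifies : List ℕ → ℕ → ℕ → Bool
qualifies x s v = (s ≡ᵇ 0) ∨ (v ≡ᵇ suc (asc (take s x)))

lastQualGo : List ℕ → ℕ → List (ℕ × ℕ × ℕ) → ℕ
lastQualGo x acc [] = acc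
lastQualGo x acc ((s , v , l) ∷ rs) =
  lastQualGo x (if qualifies x s v then l else acc) rs

lastQualRunLen : List ℕ → ℕ
lastQualRunLen x = lastQualGo x 0 (runsPos x)

topLeft : Σ ℕ (λ m → Matrix (suc m)) → ℕ
topLeft (m , A) = entry A Fin.zero Fin.zero

valS : Σ ℕ (λ m → Matrix (suc m)) → ℕ
valS (m , A) = val A

botRight : Σ ℕ (λ m → Matrix (suc m)) → ℕ
botRight (m , A) = entry A (lastIx m) (lastIx m)

intMat : ∀ {n} → Int n → Σ ℕ (λ m → Matrix (suc m))
intMat (m , A , _) = (m , A)

IntFibre : (n : ℕ) → (Σ ℕ (λ m → Matrix (suc m)) → ℕ) → ℕ → Set
IntFibre n s k = Σ (Int n) λ A → s (intMat A) ≡ k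

AscFibre : (n : ℕ) → (List ℕ → ℕ) → ℕ → Set
AscFibre n s k = Σ (AscSet n) λ x → s (proj₁ x) ≡ k

-- Γ(A) is Γ(f A) followed by index(A) − 1.  Each removal step either lowers val(A) by one
-- (Rem1), which lengthens the last run of Γ(f A) or, when val(A) = 1, starts a lower run, or
-- deletes a row and column (Rem2, Rem3), which starts a run after an ascent.  Following A₁₁,
-- val(A) and A_{dim,dim} through the four cases shows by induction on n that they are the
-- lengths of the first run, the last run and the last qualifying run of Γ(A); the last run
-- qualifies exactly when index(A) = dim(A).
--
-- The equidistributions come from involutions.  On Int(n), exchanging A₁₁ with A_{dim,dim} or
-- with val(A) keeps the matrix in Int(n): both entries are positive and on or above the
-- diagonal, and index(A) does not move.  On Asc(n), exchanging the length of the first run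
-- with that of the last (qualifying) run keeps the sequence of run values and the total
-- length, and these determine both the ascent condition and which runs qualify.

module Submission where

open import Defs
open import Data.Nat.Base
  using (ℕ; zero; suc; _+_; _∸_; pred; _≡ᵇ_; _<ᵇ_; _≤ᵇ_; _≤_; _<_; z≤n; s≤s)
open import Data.Nat.Properties
  using (+-0-commutativeMonoid; +-comm; +-assoc; +-identityʳ; +-suc; +-mono-≤; +-cancelˡ-≡; +-cancelʳ-≡;
         suc-injective; ≤-refl; ≤-reflexive; ≤-trans; ≤-antisym; ≤-pred; <-cmp; <⇒≢; <⇒≤; <⇒≱; ≤⇒≯;
         <-≤-trans; ≤-<-trans; ≤∧≢⇒<; m≤m+n; m≤n+m; n≤1+n; n≤0⇒n≡0;
         ≡ᵇ⇒≡; ≡⇒≡ᵇ; <ᵇ⇒<; <⇒<ᵇ; ≤ᵇ⇒≤; ≤⇒≤ᵇ; ≡-irrelevant)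
  renaming (_≟_ to _≟ℕ_)
open import Data.Nat.ListAction using (sum)
open import Data.Nat.ListAction.Properties using (sum-++)
open import Data.Nat.Tactic.RingSolver using (solve-∀)
open import Algebra.Properties.CommutativeMonoid.Sum +-0-commutativeMonoid
  using (sum-remove; sum-cong-≗; sum-init-last; sum-replicate-zero) renaming (sum to ∑)
open import Data.Bool.Base using (Bool; true; false; _∧_; _∨_; not; if_then_else_; T)
open import Data.Bool.Properties using (T-≡; T-∧; ∨-identityʳ; T-irrelevant)
open import Data.Bool.ListAction using (all)
open import Data.Empty using (⊥-elim)
open import Data.Fin.Base using (Fin; toℕ; fromℕ; inject₁; lower₁; punchIn; punchOut)
import Data.Fin.Base as Fin
open import Data.Fin.Properties
  using (_≟_; toℕ-injective; toℕ-fromℕ; toℕ<n; toℕ-inject₁; toℕ≤pred[n]; fromℕ≢inject₁; inject₁-lower₁;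
         punchIn-punchOut; punchIn-mono-≤; punchIn-injective; punchInᵢ≢i)
open import Data.List.Base as List
  using (List; []; _∷_; _++_; _∷ʳ_; [_]; length; take; replicate; map; lookup; allFin)
open import Data.List.Properties using (++-assoc; map-++; length-++; length-replicate; length-map)
open import Data.List.Relation.Unary.All using (All; []; _∷_)
import Data.List.Relation.Unary.All as All
import Data.List.Relation.Unary.All.Properties as All
import Data.List.Relation.Unary.Any.Properties as Any
open import Data.List.Relation.Unary.Linked using (Linked; []; [-]; _∷_)
import Data.List.Relation.Unary.Linked as Linked
open import Data.Maybe.Base using (just; nothing; fromMaybe)
import Data.Maybe.Base as Maybe
open import Data.Product.Base using (Σ; ∃-syntax; _×_; _,_; proj₁; proj₂)
open import Data.Product.Properties using (≡-dec)
open import Data.Vec.Base as Vec using (Vec; []; _∷_)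
open import Data.Vec.Properties using (lookup∘tabulate; tabulate∘lookup; tabulate-cong)
open import Function.Base using (_∘_; id)
open import Function.Bundles using (Equivalence; _⇔_; mk⇔; _↔_; mk↔ₛ′)
open import Relation.Nullary using (¬_; Dec; does; yes; no; contradiction)
open import Relation.Nullary.Decidable using (dec-true; dec-false)
open import Relation.Binary.Definitions using (Tri; tri<; tri≈; tri>)
open import Relation.Binary.PropositionalEquality
  using (_≡_; _≢_; refl; sym; trans; cong; cong₂; subst; subst₂; module ≡-Reasoning)

T⇒≡true : ∀ {b} → T b → b ≡ true
T⇒≡true = Equivalence.to T-≡

≡true⇒T : ∀ {b} → b ≡ true → T b
≡true⇒T = Equivalence.from T-≡

¬T⇒≡false : ∀ {b} → ¬ T b → b ≡ false
¬T⇒≡false {true}  ¬t = contradiction _ ¬t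
¬T⇒≡false {false} _  = refl

≡⇒≡ᵇ≡true : ∀ {a b} → a ≡ b → (a ≡ᵇ b) ≡ true
≡⇒≡ᵇ≡true {a} {b} = T⇒≡true ∘ ≡⇒≡ᵇ a b

≢⇒≡ᵇ≡false : ∀ {a b} → a ≢ b → (a ≡ᵇ b) ≡ false
≢⇒≡ᵇ≡false {a} {b} a≢b = ¬T⇒≡false (a≢b ∘ ≡ᵇ⇒≡ a b)

<⇒<ᵇ≡true : ∀ {a b} → a < b → (a <ᵇ b) ≡ true
<⇒<ᵇ≡true = T⇒≡true ∘ <⇒<ᵇ

≥⇒<ᵇ≡false : ∀ {a b} → b ≤ a → (a <ᵇ b) ≡ false
≥⇒<ᵇ≡false {a} {b} b≤a = ¬T⇒≡false (≤⇒≯ b≤a ∘ <ᵇ⇒< a b)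

∷≢[] : ∀ {A : Set} {a : A} {as : List A} → a ∷ as ≢ []
∷≢[] ()

∷ʳ≢[] : ∀ {A : Set} (as : List A) {a} → as ∷ʳ a ≢ []
∷ʳ≢[] []      ()
∷ʳ≢[] (_ ∷ _) ()

length-∷ʳ≢0 : ∀ {A : Set} (as : List A) a → length (as ∷ʳ a) ≢ 0
length-∷ʳ≢0 []      a ()
length-∷ʳ≢0 (_ ∷ _) a ()

ascent : ℕ → ℕ → ℕ
ascent a b = if a <ᵇ b then 1 else 0

asc-∷ʳ : ∀ xs a b → asc (xs ∷ʳ a ∷ʳ b) ≡ asc (xs ∷ʳ a) + ascent a b
asc-∷ʳ []           a b = +-comm (ascent a b) 0
asc-∷ʳ (c ∷ [])     a b =
  trans (cong (ascent c a +_) (asc-∷ʳ [] a b)) (sym (+-assoc (ascent c a) 0 (ascent a b)))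
asc-∷ʳ (c ∷ d ∷ ys) a b =
  trans (cong (ascent c d +_) (asc-∷ʳ (d ∷ ys) a b)) (sym (+-assoc (ascent c d) _ _))


ascent-< : ∀ {a b} → a < b → ascent a b ≡ 1
ascent-< a<b = cong (if_then 1 else 0) (<⇒<ᵇ≡true a<b)

ascent-≥ : ∀ {a b} → b ≤ a → ascent a b ≡ 0
ascent-≥ {a} b≤a = cong (if_then 1 else 0) (≥⇒<ᵇ≡false {a} b≤a)

consRun : ℕ → List (ℕ × ℕ) → List (ℕ × ℕ)
consRun a []             = (a , 1) ∷ []
consRun a ((b , k) ∷ rs) = if a ≡ᵇ b then (b , suc k) ∷ rs else (a , 1) ∷ (b , k) ∷ rs

runs-∷ : ∀ a xs → runs (a ∷ xs) ≡ consRun a (runs xs)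
runs-∷ a xs with runs xs
... | []           = refl
... | (b , k) ∷ rs = refl

snocRun : List (ℕ × ℕ) → ℕ → List (ℕ × ℕ)
snocRun []                  i = (i , 1) ∷ []
snocRun ((v , l) ∷ [])      i = if v ≡ᵇ i then (v , suc l) ∷ [] else (v , l) ∷ (i , 1) ∷ []
snocRun (r ∷ r′ ∷ rs)       i = r ∷ snocRun (r′ ∷ rs) i

consRun-snocRun : ∀ a R i → consRun a (snocRun R i) ≡ snocRun (consRun a R) i
consRun-snocRun a [] i with a ≡ᵇ i in a≡ᵇi
... | true  rewrite ≡ᵇ⇒≡ a i (≡true⇒T a≡ᵇi) = refl
... | false = refl
consRun-snocRun a ((b , k) ∷ []) i with b ≡ᵇ i in b≡ᵇi | a ≡ᵇ b in a≡ᵇb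
... | true | true
  rewrite ≡ᵇ⇒≡ b i (≡true⇒T b≡ᵇi) | ≡ᵇ⇒≡ a i (≡true⇒T a≡ᵇb) | ≡⇒≡ᵇ≡true {i} refl = refl
... | true  | false rewrite ≡ᵇ⇒≡ b i (≡true⇒T b≡ᵇi) | a≡ᵇb | ≡⇒≡ᵇ≡true {i} refl = refl
... | false | true  rewrite b≡ᵇi | a≡ᵇb = refl
... | false | false rewrite b≡ᵇi | a≡ᵇb = refl
consRun-snocRun a ((b , k) ∷ r′ ∷ rs) i with a ≡ᵇ b
... | true  = refl
... | false = refl

runs-∷ʳ : ∀ xs i → runs (xs ∷ʳ i) ≡ snocRun (runs xs) i
runs-∷ʳ []       i = refl
runs-∷ʳ (a ∷ xs) i = begin
  runs (a ∷ xs ∷ʳ i)            ≡⟨ runs-∷ a (xs ∷ʳ i) ⟩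
  consRun a (runs (xs ∷ʳ i))    ≡⟨ cong (consRun a) (runs-∷ʳ xs i) ⟩
  consRun a (snocRun (runs xs) i) ≡⟨ consRun-snocRun a (runs xs) i ⟩
  snocRun (consRun a (runs xs)) i ≡⟨ cong (λ R → snocRun R i) (runs-∷ a xs) ⟨
  snocRun (runs (a ∷ xs)) i     ∎
  where open ≡-Reasoning

snocRun-extend : ∀ R v l → snocRun (R ∷ʳ (v , l)) v ≡ R ∷ʳ (v , suc l)
snocRun-extend []            v l rewrite ≡⇒≡ᵇ≡true {v} refl = refl
snocRun-extend (r ∷ [])      v l = cong (r ∷_) (snocRun-extend [] v l)
snocRun-extend (r ∷ r′ ∷ R)  v l = cong (r ∷_) (snocRun-extend (r′ ∷ R) v l)

snocRun-new : ∀ R v l i → v ≢ i → snocRun (R ∷ʳ (v , l)) i ≡ R ∷ʳ (v , l) ∷ʳ (i , 1)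
snocRun-new []           v l i v≢i rewrite ≢⇒≡ᵇ≡false v≢i = refl
snocRun-new (r ∷ [])     v l i v≢i = cong (r ∷_) (snocRun-new [] v l i v≢i)
snocRun-new (r ∷ r′ ∷ R) v l i v≢i = cong (r ∷_) (snocRun-new (r′ ∷ R) v l i v≢i)

totalLength : List (ℕ × ℕ) → ℕ
totalLength R = sum (map proj₂ R)

totalLength-++ : ∀ P Q → totalLength (P ++ Q) ≡ totalLength P + totalLength Q
totalLength-++ P Q = trans (cong sum (map-++ proj₂ P Q)) (sum-++ (map proj₂ P) (map proj₂ Q))

totalLength-runs : ∀ xs → totalLength (runs xs) ≡ length xs
totalLength-runs []       = refl
totalLength-runs (a ∷ xs) =
  trans (cong totalLength (runs-∷ a xs)) (trans (consRun-suc a (runs xs)) (cong suc (totalLength-runs xs)))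
  where
  consRun-suc : ∀ a R → totalLength (consRun a R) ≡ suc (totalLength R)
  consRun-suc a []            = refl
  consRun-suc a ((b , k) ∷ R) with a ≡ᵇ b
  ... | true  = refl
  ... | false = refl

addPos-++ : ∀ s P Q → addPos s (P ++ Q) ≡ addPos s P ++ addPos (s + totalLength P) Q
addPos-++ s []            Q = cong (λ t → addPos t Q) (sym (+-identityʳ s))
addPos-++ s ((v , l) ∷ P) Q = cong ((s , v , l) ∷_) (trans (addPos-++ (s + l) P Q)
  (cong (λ t → addPos (s + l) P ++ addPos t Q) (+-assoc s l (totalLength P))))

headLength : List (ℕ × ℕ) → ℕ
headLength []            = 0
headLength ((_ , l) ∷ _) = l

firstRunLen≡headLength : ∀ x → firstRunLen x ≡ headLength (runs x)
firstRunLen≡headLength x with runs x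
... | []          = refl
... | (v , l) ∷ _ = refl

headLength-∷ʳ : ∀ P {e e′} → headLength (P ∷ʳ e ∷ʳ e′) ≡ headLength (P ∷ʳ e)
headLength-∷ʳ []      = refl
headLength-∷ʳ (_ ∷ _) = refl

lastLen-∷ʳ : ∀ R v l → lastLen (R ∷ʳ (v , l)) ≡ l
lastLen-∷ʳ []           v l = refl
lastLen-∷ʳ (r ∷ [])     v l = refl
lastLen-∷ʳ (r ∷ r′ ∷ R) v l = lastLen-∷ʳ (r′ ∷ R) v l

lastQualGo-∷ʳ : ∀ x acc P s v l →
  lastQualGo x acc (P ∷ʳ (s , v , l)) ≡ (if qualifies x s v then l else lastQualGo x acc P)
lastQualGo-∷ʳ x acc []                  s v l = refl
lastQualGo-∷ʳ x acc ((s′ , v′ , l′) ∷ P) s v l = lastQualGo-∷ʳ x _ P s v l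

lastQualRunLen-∷ʳ : ∀ x R v l → runs x ≡ R ∷ʳ (v , l) →
  lastQualRunLen x ≡ (if qualifies x (totalLength R) v then l else lastQualGo x 0 (addPos 0 R))
lastQualRunLen-∷ʳ x R v l runs≡ = begin
  lastQualGo x 0 (addPos 0 (runs x))            ≡⟨ cong (lastQualGo x 0 ∘ addPos 0) runs≡ ⟩
  lastQualGo x 0 (addPos 0 (R ∷ʳ (v , l)))      ≡⟨ cong (lastQualGo x 0) (addPos-++ 0 R _) ⟩
  lastQualGo x 0 (addPos 0 R ∷ʳ (totalLength R , v , l)) ≡⟨ lastQualGo-∷ʳ x 0 (addPos 0 R) _ v l ⟩
  _                                             ∎
  where open ≡-Reasoning

take-++ˡ : ∀ s (y z : List ℕ) → s ≤ length y → take s (y ++ z) ≡ take s y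
take-++ˡ zero    y       z _         = refl
take-++ˡ (suc s) (a ∷ y) z (s≤s s≤y) = cong (a ∷_) (take-++ˡ s y z s≤y)

take-length-++ : ∀ (y z : List ℕ) → take (length y) (y ++ z) ≡ y
take-length-++ []      z = refl
take-length-++ (a ∷ y) z = cong (a ∷_) (take-length-++ y z)

qualifies-++ : ∀ y z s v → s ≤ length y → qualifies (y ++ z) s v ≡ qualifies y s v
qualifies-++ y z s v s≤y rewrite take-++ˡ s y z s≤y = refl

lastQualGo-++ : ∀ y z acc s P → s + totalLength P ≤ length y →
  lastQualGo (y ++ z) acc (addPos s P) ≡ lastQualGo y acc (addPos s P)
lastQualGo-++ y z acc s []            _  = refl
lastQualGo-++ y z acc s ((v , l) ∷ P) le
  rewrite qualifies-++ y z s v (≤-trans (m≤m+n s (l + totalLength P)) le) =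
  lastQualGo-++ y z _ (s + l) P (subst (_≤ length y) (sym (+-assoc s l (totalLength P))) le)

ascent-new-pos : ∀ {i j m} → i ≢ j → i ≤ m → m + ascent i j ≢ 0
ascent-new-pos {i} {j} {m} i≢j i≤m with <-cmp i j
... | tri< i<j _ _ rewrite ascent-< i<j | +-comm m 1 = λ ()
... | tri≈ _ i≡j _ = contradiction i≡j i≢j
... | tri> _ _ j<i rewrite ascent-≥ (<⇒≤ j<i) | +-identityʳ m = <⇒≢ (<-≤-trans (s≤s z≤n) (<-≤-trans j<i i≤m)) ∘ sym

ascent-new-≡ᵇ : ∀ {i j m} → i ≢ j → i ≤ m → (j ≡ᵇ suc m) ≡ (j ≡ᵇ m + ascent i j)
ascent-new-≡ᵇ {i} {j} {m} i≢j i≤m with <-cmp i j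
... | tri< i<j _ _ rewrite ascent-< i<j | +-comm m 1 = refl
... | tri≈ _ i≡j _ = contradiction i≡j i≢j
... | tri> _ _ j<i rewrite ascent-≥ (<⇒≤ j<i) | +-identityʳ m =
  trans (≢⇒≡ᵇ≡false (<⇒≢ (≤-trans j<m (n≤1+n m)))) (sym (≢⇒≡ᵇ≡false (<⇒≢ j<m)))
  where j<m = <-≤-trans j<i i≤m

-- The shape of x = Γ(A) maintained by the induction, where m = dim(A) − 1, i = index(A) − 1,
-- v = val(A), a = A₁₁ and z = A_{dim,dim}.

record Profile (x : List ℕ) (m i v a z : ℕ) : Set where
  field
    init            : List ℕ
    x≡init∷ʳi       : x ≡ init ∷ʳ i
    initRuns        : List (ℕ × ℕ)
    runs≡           : runs x ≡ initRuns ∷ʳ (i , v)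
    asc≡            : asc x ≡ m
    i≤m             : i ≤ m
    initRuns≡[]⇔    : initRuns ≡ [] ⇔ m ≡ 0
    firstRunLen≡    : firstRunLen x ≡ a
    lastQualifies   : qualifies x (totalLength initRuns) i ≡ (i ≡ᵇ m)
    lastQualRunLen≡ : lastQualRunLen x ≡ z

Profile-singleton : Profile (0 ∷ []) 0 0 1 1 1
Profile-singleton = record
  { init = [] ; x≡init∷ʳi = refl ; initRuns = [] ; runs≡ = refl ; asc≡ = refl ; i≤m = z≤n
  ; initRuns≡[]⇔ = mk⇔ (λ _ → refl) (λ _ → refl) ; firstRunLen≡ = refl
  ; lastQualifies = refl ; lastQualRunLen≡ = refl }

Profile-cong : ∀ {x m i v a z m′ i′ v′ a′ z′} → m ≡ m′ → i ≡ i′ → v ≡ v′ → a ≡ a′ → z ≡ z′ →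
  Profile x m i v a z → Profile x m′ i′ v′ a′ z′
Profile-cong refl refl refl refl refl P = P

module _ {x m i v a z} (P : Profile x m i v a z) where
  open Profile P

  private
    open ≡-Reasoning

    asc-∷ʳ-x : ∀ j → asc (x ∷ʳ j) ≡ m + ascent i j
    asc-∷ʳ-x j = begin
      asc (x ∷ʳ j)                 ≡⟨ cong (λ y → asc (y ∷ʳ j)) x≡init∷ʳi ⟩
      asc (init ∷ʳ i ∷ʳ j)         ≡⟨ asc-∷ʳ init i j ⟩
      asc (init ∷ʳ i) + ascent i j ≡⟨ cong (_+ ascent i j) (trans (cong asc (sym x≡init∷ʳi)) asc≡) ⟩
      m + ascent i j               ∎

    lastRunEnd : totalLength (initRuns ∷ʳ (i , v)) ≡ length x
    lastRunEnd = trans (cong totalLength (sym runs≡)) (totalLength-runs x)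

    lastRunStart≤ : totalLength initRuns ≤ length x
    lastRunStart≤ = subst (totalLength initRuns ≤_) (trans (sym (totalLength-++ initRuns _)) lastRunEnd) (m≤m+n _ _)

    lastQualRunLen-x : lastQualRunLen x ≡ (if i ≡ᵇ m then v else lastQualGo x 0 (addPos 0 initRuns))
    lastQualRunLen-x = trans (lastQualRunLen-∷ʳ x initRuns i v runs≡) (cong (if_then v else _) lastQualifies)

    runs-extend : runs (x ∷ʳ i) ≡ initRuns ∷ʳ (i , suc v)
    runs-extend = trans (runs-∷ʳ x i) (trans (cong (λ R → snocRun R i) runs≡) (snocRun-extend initRuns i v))

    qualifies-extend : qualifies (x ∷ʳ i) (totalLength initRuns) i ≡ (i ≡ᵇ m)
    qualifies-extend = trans (qualifies-++ x [ i ] _ i lastRunStart≤) lastQualifies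

    -- Appending i lengthens the last run; it qualifies (or not) as before.
    lastQualRunLen-extend : lastQualRunLen (x ∷ʳ i) ≡ (if i ≡ᵇ m then suc z else z)
    lastQualRunLen-extend = begin
      lastQualRunLen (x ∷ʳ i)
        ≡⟨ lastQualRunLen-∷ʳ (x ∷ʳ i) initRuns i (suc v) runs-extend ⟩
      (if qualifies (x ∷ʳ i) (totalLength initRuns) i then suc v else lastQualGo (x ∷ʳ i) 0 (addPos 0 initRuns))
        ≡⟨ cong₂ (if_then suc v else_) qualifies-extend (lastQualGo-++ x [ i ] 0 0 initRuns lastRunStart≤) ⟩
      (if i ≡ᵇ m then suc v else lastQualGo x 0 (addPos 0 initRuns))
        ≡⟨ if-suc (i ≡ᵇ m) (trans (sym lastQualRunLen≡) lastQualRunLen-x) ⟩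
      (if i ≡ᵇ m then suc z else z) ∎
      where
      if-suc : ∀ b {w} → z ≡ (if b then v else w) → (if b then suc v else w) ≡ (if b then suc z else z)
      if-suc true  refl = refl
      if-suc false refl = refl

    firstRunLen-extend : firstRunLen (x ∷ʳ i) ≡ (if m ≡ᵇ 0 then suc v else a)
    firstRunLen-extend = trans (firstRunLen≡headLength (x ∷ʳ i)) (trans (cong headLength runs-extend) (by-initRuns initRuns refl))
      where
      by-initRuns : ∀ R → R ≡ initRuns → headLength (R ∷ʳ (i , suc v)) ≡ (if m ≡ᵇ 0 then suc v else a)
      by-initRuns []      R≡ rewrite ≡⇒≡ᵇ≡true (Equivalence.to initRuns≡[]⇔ (sym R≡)) = refl
      by-initRuns (r ∷ R) R≡
        rewrite ≢⇒≡ᵇ≡false (λ m≡0 → ∷≢[] (trans R≡ (Equivalence.from initRuns≡[]⇔ m≡0))) =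
        trans (cong headLength (sym (trans runs≡ (cong (_∷ʳ (i , v)) (sym R≡)))))
              (trans (sym (firstRunLen≡headLength x)) firstRunLen≡)

  Profile-extend : Profile (x ∷ʳ i) m i (suc v) (if m ≡ᵇ 0 then suc v else a) (if i ≡ᵇ m then suc z else z)
  Profile-extend = record
    { init = x ; x≡init∷ʳi = refl ; initRuns = initRuns ; runs≡ = runs-extend
    ; asc≡ = trans (asc-∷ʳ-x i) (trans (cong (m +_) (ascent-≥ {i} ≤-refl)) (+-identityʳ m))
    ; i≤m = i≤m ; initRuns≡[]⇔ = initRuns≡[]⇔ ; firstRunLen≡ = firstRunLen-extend
    ; lastQualifies = qualifies-extend ; lastQualRunLen≡ = lastQualRunLen-extend
    }

  module _ {j} (i≢j : i ≢ j) where

    private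
      runs-new : runs (x ∷ʳ j) ≡ initRuns ∷ʳ (i , v) ∷ʳ (j , 1)
      runs-new = trans (runs-∷ʳ x j) (trans (cong (λ R → snocRun R j) runs≡) (snocRun-new initRuns i v j i≢j))

      qualifies-new : qualifies (x ∷ʳ j) (totalLength (initRuns ∷ʳ (i , v))) j ≡ (j ≡ᵇ m + ascent i j)
      qualifies-new = begin
        qualifies (x ∷ʳ j) (totalLength (initRuns ∷ʳ (i , v))) j
          ≡⟨ cong (λ s → qualifies (x ∷ʳ j) s j) lastRunEnd ⟩
        (length x ≡ᵇ 0) ∨ (j ≡ᵇ suc (asc (take (length x) (x ∷ʳ j))))
          ≡⟨ cong₂ (λ b y → b ∨ (j ≡ᵇ suc (asc y))) (≢⇒≡ᵇ≡false length-x≢0) (take-length-++ x [ j ]) ⟩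
        (j ≡ᵇ suc (asc x))    ≡⟨ cong (λ t → j ≡ᵇ suc t) asc≡ ⟩
        (j ≡ᵇ suc m)          ≡⟨ ascent-new-≡ᵇ i≢j i≤m ⟩
        (j ≡ᵇ m + ascent i j) ∎
        where
        length-x≢0 : length x ≢ 0
        length-x≢0 = subst (λ y → length y ≢ 0) (sym x≡init∷ʳi) (length-∷ʳ≢0 init i)

      lastQualRunLen-new : lastQualRunLen (x ∷ʳ j) ≡ (if j ≡ᵇ m + ascent i j then 1 else z)
      lastQualRunLen-new = begin
        lastQualRunLen (x ∷ʳ j)
          ≡⟨ lastQualRunLen-∷ʳ (x ∷ʳ j) (initRuns ∷ʳ (i , v)) j 1 runs-new ⟩
        (if qualifies (x ∷ʳ j) (totalLength (initRuns ∷ʳ (i , v))) j then 1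
         else lastQualGo (x ∷ʳ j) 0 (addPos 0 (initRuns ∷ʳ (i , v))))
          ≡⟨ cong₂ (if_then 1 else_) qualifies-new
               (lastQualGo-++ x [ j ] 0 0 (initRuns ∷ʳ (i , v)) (≤-reflexive lastRunEnd)) ⟩
        (if j ≡ᵇ m + ascent i j then 1 else lastQualGo x 0 (addPos 0 (initRuns ∷ʳ (i , v))))
          ≡⟨ cong (if j ≡ᵇ m + ascent i j then 1 else_)
               (trans (cong (lastQualGo x 0 ∘ addPos 0) (sym runs≡)) lastQualRunLen≡) ⟩
        (if j ≡ᵇ m + ascent i j then 1 else z) ∎

    Profile-newRun : j ≤ m + ascent i j → Profile (x ∷ʳ j) (m + ascent i j) j 1 a (if j ≡ᵇ m + ascent i j then 1 else z)
    Profile-newRun j≤m′ = record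
      { init = x ; x≡init∷ʳi = refl ; initRuns = initRuns ∷ʳ (i , v) ; runs≡ = runs-new
      ; asc≡ = asc-∷ʳ-x j ; i≤m = j≤m′
      ; initRuns≡[]⇔ = mk⇔ (λ e → contradiction e (∷ʳ≢[] initRuns)) (λ e → contradiction e (ascent-new-pos i≢j i≤m))
      ; firstRunLen≡ = trans (firstRunLen≡headLength (x ∷ʳ j)) (trans (cong headLength runs-new)
                         (trans (headLength-∷ʳ initRuns) (trans (cong headLength (sym runs≡))
                         (trans (sym (firstRunLen≡headLength x)) firstRunLen≡))))
      ; lastQualifies = qualifies-new ; lastQualRunLen≡ = lastQualRunLen-new
      }

  Profile-ascent : ∀ {j} → i < j → j ≤ suc m → Profile (x ∷ʳ j) (suc m) j 1 a (if j ≡ᵇ suc m then 1 else z)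
  Profile-ascent {j} i<j j≤1+m = Profile-cong m′≡ refl refl refl (cong (λ t → if j ≡ᵇ t then 1 else z) m′≡)
    (Profile-newRun (<⇒≢ i<j) (subst (j ≤_) (sym m′≡) j≤1+m))
    where
    m′≡ : m + ascent i j ≡ suc m
    m′≡ = trans (cong (m +_) (ascent-< i<j)) (+-comm m 1)

  Profile-descent : ∀ {j} → j < i → Profile (x ∷ʳ j) m j 1 a z
  Profile-descent {j} j<i = Profile-cong m′≡ refl refl refl
    (cong (if_then 1 else z) (≢⇒≡ᵇ≡false (<⇒≢ (<-≤-trans j<i i≤m) ∘ (λ e → trans e m′≡))))
    (Profile-newRun (<⇒≢ j<i ∘ sym) (subst (j ≤_) (sym m′≡) (<⇒≤ (<-≤-trans j<i i≤m))))
    where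
    m′≡ : m + ascent i j ≡ m
    m′≡ = trans (cong (m +_) (ascent-≥ (<⇒≤ j<i))) (+-identityʳ m)

∑∑ : ∀ {d} → (Fin d → Fin d → ℕ) → ℕ
∑∑ a = ∑ (λ i → ∑ (a i))

sum-lookup : ∀ {k} (v : Vec ℕ k) → Vec.sum v ≡ ∑ (Vec.lookup v)
sum-lookup []      = refl
sum-lookup (x ∷ v) = cong (x +_) (sum-lookup v)

sumM≡∑∑ : ∀ {d} (A : Matrix d) → sumM A ≡ ∑∑ (entry A)
sumM≡∑∑ = go
  where
  go : ∀ {r c} (V : Vec (Vec ℕ c) r) → Vec.sum (Vec.map Vec.sum V) ≡ ∑ (λ i → ∑ (Vec.lookup (Vec.lookup V i)))
  go []        = refl
  go (row ∷ V) = cong₂ _+_ (sum-lookup row) (go V)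

entry-tabulate : ∀ {d} (h : Fin d → Fin d → ℕ) r c → entry {d} (Vec.tabulate λ r → Vec.tabulate (h r)) r c ≡ h r c
entry-tabulate h r c =
  trans (cong (λ v → Vec.lookup v c) (lookup∘tabulate (λ r → Vec.tabulate (h r)) r)) (lookup∘tabulate (h r) c)

∑-≥ : ∀ {k} (a : Fin k → ℕ) j → a j ≤ ∑ a
∑-≥ {suc k} a j = subst (a j ≤_) (sym (sum-remove a)) (m≤m+n _ _)

∑-≥-size : ∀ {k} (a : Fin k → ℕ) → (∀ i → 1 ≤ a i) → k ≤ ∑ a
∑-≥-size {zero}  a pos = z≤n
∑-≥-size {suc k} a pos = +-mono-≤ (pos Fin.zero) (∑-≥-size (a ∘ Fin.suc) (pos ∘ Fin.suc))

∑-zero : ∀ {k} (a : Fin k → ℕ) → (∀ j → a j ≡ 0) → ∑ a ≡ 0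
∑-zero {k} a a≡0 = trans (sum-cong-≗ a≡0) (sum-replicate-zero k)

-- Stated additively to avoid truncated subtraction.
∑-update : ∀ {k} (a a′ : Fin k → ℕ) j → (∀ r → r ≢ j → a r ≡ a′ r) → ∑ a′ + a j ≡ ∑ a + a′ j
∑-update {suc k} a a′ j a≡a′ = begin
  ∑ a′ + a j                            ≡⟨ cong (_+ a j) (sum-remove a′) ⟩
  (a′ j + ∑ (a′ ∘ punchIn j)) + a j     ≡⟨ cong (λ s → (a′ j + s) + a j) (sum-cong-≗ rest) ⟩
  (a′ j + ∑ (a ∘ punchIn j)) + a j      ≡⟨ swap-outer (a′ j) _ (a j) ⟩
  (a j + ∑ (a ∘ punchIn j)) + a′ j      ≡⟨ cong (_+ a′ j) (sum-remove a) ⟨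
  ∑ a + a′ j                            ∎
  where
  open ≡-Reasoning
  rest : ∀ r → a′ (punchIn j r) ≡ a (punchIn j r)
  rest r = sym (a≡a′ (punchIn j r) (punchInᵢ≢i j r))
  swap-outer : ∀ x y z → (x + y) + z ≡ (z + y) + x
  swap-outer = solve-∀

-- Two successive one-summand changes, through an intermediate sum s′.
+-transfer : ∀ X X′ s s′ u u′ → X′ + s ≡ X + s′ → s′ + u ≡ s + u′ → X′ + u ≡ X + u′
+-transfer X X′ s s′ u u′ outer inner = +-cancelʳ-≡ s _ _ (begin
  (X′ + u) + s   ≡⟨ right-comm X′ u s ⟩
  (X′ + s) + u   ≡⟨ cong (_+ u) outer ⟩
  (X + s′) + u   ≡⟨ assoc X s′ u ⟩
  X + (s′ + u)   ≡⟨ cong (X +_) inner ⟩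
  X + (s + u′)   ≡⟨ assoc-comm X s u′ ⟩
  (X + u′) + s   ∎)
  where
  open ≡-Reasoning
  right-comm : ∀ x y z → (x + y) + z ≡ (x + z) + y
  right-comm = solve-∀
  assoc : ∀ x y z → (x + y) + z ≡ x + (y + z)
  assoc = solve-∀
  assoc-comm : ∀ x y z → x + (y + z) ≡ (x + z) + y
  assoc-comm = solve-∀

∑∑-update : ∀ {d} (a a′ : Fin d → Fin d → ℕ) r c →
  (∀ r′ c′ → (r′ , c′) ≢ (r , c) → a r′ c′ ≡ a′ r′ c′) → ∑∑ a′ + a r c ≡ ∑∑ a + a′ r c
∑∑-update a a′ r c a≡a′ = +-transfer (∑∑ a) (∑∑ a′) (∑ (a r)) (∑ (a′ r)) (a r c) (a′ r c)
  (∑-update (λ i → ∑ (a i)) (λ i → ∑ (a′ i)) r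
     (λ r′ r′≢r → sum-cong-≗ (λ c′ → a≡a′ r′ c′ (r′≢r ∘ cong proj₁))))
  (∑-update (a r) (a′ r) c (λ c′ c′≢c → a≡a′ r c′ (c′≢c ∘ cong proj₂)))

record IsInt (n d : ℕ) (a : Fin d → Fin d → ℕ) : Set where
  field
    ∑∑≡    : ∑∑ a ≡ n
    upper  : ∀ i j → toℕ j < toℕ i → a i j ≡ 0
    rowPos : ∀ i → ∃[ j ] 0 < a i j
    colPos : ∀ j → ∃[ i ] 0 < a i j

IsInt-cong : ∀ {n d} {a b : Fin d → Fin d → ℕ} → (∀ i j → a i j ≡ b i j) → IsInt n d a → IsInt n d b
IsInt-cong {d = d} a≡b P = record
  { ∑∑≡    = trans (sum-cong-≗ (λ i → sum-cong-≗ (λ j → sym (a≡b i j)))) ∑∑≡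
  ; upper  = λ i j j<i → trans (sym (a≡b i j)) (upper i j j<i)
  ; rowPos = λ i → let j , p = rowPos i in j , subst (0 <_) (a≡b i j) p
  ; colPos = λ j → let i , p = colPos j in i , subst (0 <_) (a≡b i j) p
  }
  where open IsInt P

T-allF : ∀ {k} {p : Fin k → Bool} → T (allF k p) ⇔ (∀ i → T (p i))
T-allF {k} {p} = mk⇔ (All.tabulate⁻ ∘ All.all⁺ p (allFin k)) (All.all⁻ p ∘ All.tabulate⁺)

T-anyF : ∀ {k} {p : Fin k → Bool} → T (anyF k p) ⇔ (∃[ i ] T (p i))
T-anyF {k} {p} = mk⇔ (Any.tabulate⁻ ∘ Any.any⁻ p (allFin k)) (λ (i , pi) → Any.any⁺ p (Any.tabulate⁺ i pi))

T-upper : ∀ {a b x} → T (not (a <ᵇ b) ∨ (x ≡ᵇ 0)) ⇔ (a < b → x ≡ 0)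
T-upper {a} {b} {x} with a <ᵇ b in a<ᵇb
... | false = mk⇔ (λ _ a<b → ⊥-elim (subst T a<ᵇb (<⇒<ᵇ a<b))) (λ _ → _)
... | true  = mk⇔ (λ t _ → ≡ᵇ⇒≡ x 0 t) (λ x≡0 → ≡⇒≡ᵇ x 0 (x≡0 (<ᵇ⇒< a b (≡true⇒T a<ᵇb))))

T-pos : ∀ {x} → T (0 <ᵇ x) ⇔ 0 < x
T-pos {x} = mk⇔ (<ᵇ⇒< 0 x) <⇒<ᵇ

isInt⇔IsInt : ∀ {d} n (A : Matrix d) → T (isInt n A) ⇔ IsInt n d (entry A)
isInt⇔IsInt {d} n A = mk⇔ sound complete
  where
  open Equivalence using (to; from)
  sound : T (isInt n A) → IsInt n d (entry A)
  sound t with to T-∧ t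
  ... | s , t′ with to T-∧ t′
  ... | u , t″ with to T-∧ t″
  ... | r , c = record
    { ∑∑≡    = trans (sym (sumM≡∑∑ A)) (≡ᵇ⇒≡ _ n s)
    ; upper  = λ i j → to T-upper (to T-allF (to T-allF u i) j)
    ; rowPos = λ i → let j , p = to T-anyF (to T-allF r i) in j , to T-pos p
    ; colPos = λ j → let i , p = to T-anyF (to T-allF c j) in i , to T-pos p
    }
  complete : IsInt n d (entry A) → T (isInt n A)
  complete P = from T-∧ (≡⇒≡ᵇ _ n (trans (sumM≡∑∑ A) ∑∑≡) , from T-∧
    ( from T-allF (λ i → from T-allF (λ j → from T-upper (upper i j)))
    , from T-∧ ( from T-allF (λ i → let j , p = rowPos i in from T-anyF (j , from T-pos p))
               , from T-allF (λ j → let i , p = colPos j in from T-anyF (i , from T-pos p)))))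
    where open IsInt P

IsFirstPositive : ∀ {k} → (Fin k → ℕ) → Fin k → Set
IsFirstPositive h i = 0 < h i × (∀ r → toℕ r < toℕ i → h r ≡ 0)

fromMaybe-map-suc : ∀ {k} (d : Fin k) X → fromMaybe (Fin.suc d) (Maybe.map Fin.suc X) ≡ Fin.suc (fromMaybe d X)
fromMaybe-map-suc d (just x) = refl
fromMaybe-map-suc d nothing  = refl

findFirst-spec : ∀ {k} (h : Fin k → ℕ) dflt → 0 < h dflt → IsFirstPositive h (fromMaybe dflt (findFirst h))
findFirst-spec {suc k} h dflt h-pos with h Fin.zero in h₀≡
findFirst-spec {suc k} h dflt h-pos | suc _ = subst (0 <_) (sym h₀≡) (s≤s z≤n) , λ _ ()
findFirst-spec {suc k} h Fin.zero h-pos | zero = contradiction h₀≡ (<⇒≢ h-pos ∘ sym)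
findFirst-spec {suc k} h (Fin.suc dflt) h-pos | zero
  rewrite fromMaybe-map-suc dflt (findFirst (h ∘ Fin.suc)) =
  let h-pos′ , zeros = findFirst-spec (h ∘ Fin.suc) dflt h-pos
  in h-pos′ , λ { Fin.zero _ → h₀≡ ; (Fin.suc r) (s≤s r<i) → zeros r r<i }

IsFirstPositive-≤ : ∀ {k} {h : Fin k → ℕ} {i} → IsFirstPositive h i → ∀ r → 0 < h r → toℕ i ≤ toℕ r
IsFirstPositive-≤ {i = i} (_ , zeros) r h-pos with <-cmp (toℕ r) (toℕ i)
... | tri< r<i _ _ = contradiction (zeros r r<i) (<⇒≢ h-pos ∘ sym)
... | tri≈ _ r≡i _ = subst (_≤ toℕ r) r≡i ≤-refl
... | tri> _ _ i<r = <⇒≤ i<r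

IsFirstPositive-unique : ∀ {k} {h : Fin k → ℕ} {i j} → IsFirstPositive h i → IsFirstPositive h j → i ≡ j
IsFirstPositive-unique fi fj =
  toℕ-injective (≤-antisym (IsFirstPositive-≤ fi _ (proj₁ fj)) (IsFirstPositive-≤ fj _ (proj₁ fi)))

≡lastIx : ∀ {m} (j : Fin (suc m)) → toℕ j ≡ m → j ≡ lastIx m
≡lastIx {m} j j≡m = toℕ-injective (trans j≡m (sym (toℕ-fromℕ m)))

module IntMatrix {n m : ℕ} (A : Matrix (suc m)) (P : IsInt n (suc m) (entry A)) where
  open IsInt P

  a = entry A
  last = lastIx m
  idx = index A

  a-last-last-pos : 0 < a last last
  a-last-last-pos with rowPos last
  ... | j , p with <-cmp (toℕ j) m
  ...   | tri< j<m _ _ = contradiction (upper last j (subst (toℕ j <_) (sym (toℕ-fromℕ m)) j<m)) (<⇒≢ p ∘ sym)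
  ...   | tri≈ _ j≡m _ = subst (λ c → 0 < a last c) (≡lastIx j j≡m) p
  ...   | tri> _ _ m<j = contradiction (toℕ≤pred[n] j) (<⇒≱ m<j)

  a₀₀-pos : 0 < a Fin.zero Fin.zero
  a₀₀-pos with colPos Fin.zero
  ... | Fin.zero  , p = p
  ... | Fin.suc i , p = contradiction (upper (Fin.suc i) Fin.zero (s≤s z≤n)) (<⇒≢ p ∘ sym)

  index-first : IsFirstPositive (λ r → a r last) idx
  index-first = findFirst-spec (λ r → a r last) last a-last-last-pos

  val-pos : 0 < val A
  val-pos = proj₁ index-first

  above-index : ∀ r → toℕ r < toℕ idx → a r last ≡ 0
  above-index = proj₂ index-first

IsInt⇒dim≤n : ∀ {n d a} → IsInt n d a → d ≤ n
IsInt⇒dim≤n {a = a} P = subst (_ ≤_) ∑∑≡ (∑-≥-size (λ i → ∑ (a i)) row-sum-pos)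
  where
  open IsInt P
  row-sum-pos : ∀ i → 1 ≤ ∑ (a i)
  row-sum-pos i = let j , p = rowPos i in ≤-trans p (∑-≥ (a i) j)

last≢zero : ∀ {m} → m ≢ 0 → lastIx m ≢ Fin.zero
last≢zero {m} m≢0 last≡0 = m≢0 (trans (sym (toℕ-fromℕ m)) (cong toℕ last≡0))

Fin1-unique : ∀ {m} → m ≡ 0 → (j : Fin (suc m)) → j ≡ Fin.zero
Fin1-unique m≡0 j = toℕ-injective (n≤0⇒n≡0 (subst (toℕ j ≤_) m≡0 (toℕ≤pred[n] j)))

data Removal {m} (A : Matrix (suc m)) : Set where
  decreaseLarge : ∀ v₀ → val A ≡ suc (suc v₀) → f A ≡ (suc m , rem1 A) → Removal A
  decreaseUnit  : val A ≡ 1 → toℕ (index A) < m → T (otherPos A) → f A ≡ (suc m , rem1 A) → Removal A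
  deleteLast    : val A ≡ 1 → toℕ (index A) ≡ m → f A ≡ (m , rem2 A) → Removal A
  deleteIndex   : val A ≡ 1 → toℕ (index A) < m → ¬ T (otherPos A) → f A ≡ (m , rem3 A) → Removal A

private
  branch : ∀ {m} → Matrix (suc m) → Bool → Bool → Σ ℕ Matrix
  branch {m} A b₁ b₂ = if b₁ then (suc m , rem1 A) else if b₂ then (m , rem2 A) else (m , rem3 A)

  f≡branch : ∀ {m} (A : Matrix (suc m)) v → val A ≡ v →
    f A ≡ branch A ((1 <ᵇ v) ∨ ((v ≡ᵇ 1) ∧ (toℕ (index A) <ᵇ m) ∧ otherPos A))
                   ((v ≡ᵇ 1) ∧ (toℕ (index A) ≡ᵇ m))
  f≡branch A v refl = refl

removal : ∀ {m} (A : Matrix (suc m)) → 0 < val A → Removal A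
removal {m} A val-pos with val A in val≡
... | suc (suc v₀) = decreaseLarge v₀ val≡ (f≡branch A _ val≡)
... | suc zero with <-cmp (toℕ (index A)) m
...   | tri≈ _ idx≡m _ = deleteLast val≡ idx≡m (trans (f≡branch A 1 val≡)
          (cong₂ (branch A) (cong (_∧ otherPos A) (≥⇒<ᵇ≡false (≤-reflexive (sym idx≡m)))) (≡⇒≡ᵇ≡true idx≡m)))
...   | tri> _ _ m<idx = contradiction (toℕ≤pred[n] (index A)) (<⇒≱ m<idx)
...   | tri< idx<m _ _ with otherPos A in other≡
...     | true  = decreaseUnit val≡ idx<m (≡true⇒T other≡) (trans (f≡branch A 1 val≡)
                    (cong₂ (branch A) (cong₂ _∧_ (<⇒<ᵇ≡true idx<m) other≡) refl))
...     | false = deleteIndex val≡ idx<m (subst T other≡) (trans (f≡branch A 1 val≡)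
                    (cong₂ (branch A) (cong₂ _∧_ (<⇒<ᵇ≡true idx<m) other≡) (≢⇒≡ᵇ≡false (<⇒≢ idx<m))))

module DecreaseEntry {n m : ℕ} (A : Matrix (suc m)) (P : IsInt (suc n) (suc m) (entry A)) where
  open IsInt P
  open IntMatrix A P public

  B = rem1 A
  b = entry B

  b≡ : ∀ r c → b r c ≡ (if eqF r idx ∧ eqF c last then pred (a r c) else a r c)
  b≡ = entry-tabulate (λ r c → if eqF r idx ∧ eqF c last then pred (a r c) else a r c)

  b-at : b idx last ≡ pred (val A)
  b-at = trans (b≡ idx last) (cong (if_then pred (val A) else val A) (at (idx ≟ idx) (last ≟ last)))
    where
    at : (r? : Dec (idx ≡ idx)) (c? : Dec (last ≡ last)) → does r? ∧ does c? ≡ true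
    at (yes _)  (yes _)  = refl
    at (yes _)  (no c≢)  = contradiction refl c≢
    at (no r≢)  _        = contradiction refl r≢

  b-off : ∀ r c → (r , c) ≢ (idx , last) → b r c ≡ a r c
  b-off r c rc≢ = trans (b≡ r c) (cong (if_then pred (a r c) else a r c) (off (r ≟ idx) (c ≟ last)))
    where
    off : (r? : Dec (r ≡ idx)) (c? : Dec (c ≡ last)) → does r? ∧ does c? ≡ false
    off (yes refl) (yes refl) = contradiction refl rc≢
    off (yes _)    (no _)     = refl
    off (no _)     _          = refl

  ∑∑-b : ∑∑ b ≡ n
  ∑∑-b = from-val (val A) refl val-pos
    where
    open ≡-Reasoning
    from-val : ∀ v → val A ≡ v → 0 < v → ∑∑ b ≡ n
    from-val (suc w) val≡ _ = suc-injective (+-cancelʳ-≡ w _ _ (begin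
      suc (∑∑ b) + w     ≡⟨ +-suc (∑∑ b) w ⟨
      ∑∑ b + suc w       ≡⟨ cong (∑∑ b +_) val≡ ⟨
      ∑∑ b + a idx last  ≡⟨ ∑∑-update a b idx last (λ r c rc≢ → sym (b-off r c rc≢)) ⟩
      ∑∑ a + b idx last  ≡⟨ cong₂ _+_ ∑∑≡ (trans b-at (cong pred val≡)) ⟩
      suc n + w          ∎))

  IsInt-b : (∃[ j ] 0 < b idx j) → 0 < b last last → IsInt n (suc m) b
  IsInt-b row-idx b-last-last-pos = record
    { ∑∑≡    = ∑∑-b
    ; upper  = λ r c c<r → trans (b-off r c (λ { refl → <⇒≱ c<r (toℕ-last≥ r) })) (upper r c c<r)
    ; rowPos = row
    ; colPos = col
    }
    where
    toℕ-last≥ : ∀ r → toℕ r ≤ toℕ last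
    toℕ-last≥ r = subst (toℕ r ≤_) (sym (toℕ-fromℕ m)) (toℕ≤pred[n] r)
    row : ∀ r → ∃[ c ] 0 < b r c
    row r with r ≟ idx
    ... | yes refl = row-idx
    ... | no r≢ = let c , p = rowPos r in c , subst (0 <_) (sym (b-off r c (r≢ ∘ cong proj₁))) p
    col : ∀ c → ∃[ r ] 0 < b r c
    col c with c ≟ last
    ... | yes refl = last , b-last-last-pos
    ... | no c≢ = let r , p = colPos c in r , subst (0 <_) (sym (b-off r c (c≢ ∘ cong proj₂))) p

  b-above-index : ∀ r → toℕ r < toℕ idx → b r last ≡ 0
  b-above-index r r<i = trans (b-off r last (<⇒≢ r<i ∘ cong (toℕ ∘ proj₁))) (above-index r r<i)

  b₀₀≡a₀₀ : m ≢ 0 → b Fin.zero Fin.zero ≡ a Fin.zero Fin.zero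
  b₀₀≡a₀₀ m≢0 = b-off Fin.zero Fin.zero (last≢zero m≢0 ∘ sym ∘ cong proj₂)

module DecreaseLargeVal {n m : ℕ} (A : Matrix (suc m)) (P : IsInt (suc n) (suc m) (entry A))
                        (v₀ : ℕ) (val≡ : val A ≡ suc (suc v₀)) where
  open DecreaseEntry A P public

  b-at≡suc : b idx last ≡ suc v₀
  b-at≡suc = trans b-at (cong pred val≡)

  IsInt-B : IsInt n (suc m) b
  IsInt-B = IsInt-b (last , subst (0 <_) (sym b-at≡suc) (s≤s z≤n)) b-last-last-pos
    where
    b-last-last-pos : 0 < b last last
    b-last-last-pos with idx ≟ last
    ... | yes idx≡last = subst (λ r → 0 < b r last) idx≡last (subst (0 <_) (sym b-at≡suc) (s≤s z≤n))
    ... | no idx≢last  = subst (0 <_) (sym (b-off last last (idx≢last ∘ sym ∘ cong proj₁))) a-last-last-pos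

  index-B : index B ≡ idx
  index-B = IsFirstPositive-unique (IntMatrix.index-first B IsInt-B)
              (subst (0 <_) (sym b-at≡suc) (s≤s z≤n) , b-above-index)

  val-B : val B ≡ suc v₀
  val-B = trans (cong (λ r → b r last) index-B) b-at≡suc

  step : ∀ {x} → Profile x m (toℕ (index B)) (val B) (b Fin.zero Fin.zero) (b last last) →
         Profile (x ∷ʳ toℕ idx) m (toℕ idx) (val A) (a Fin.zero Fin.zero) (a last last)
  step Q = Profile-cong refl refl (sym val≡) a₀₀≡ aₘₘ≡
             (Profile-extend (Profile-cong refl (cong toℕ index-B) val-B refl refl Q))
    where
    a₀₀≡ : (if m ≡ᵇ 0 then suc (suc v₀) else b Fin.zero Fin.zero) ≡ a Fin.zero Fin.zero
    a₀₀≡ with m ≟ℕ 0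
    ... | yes m≡0 rewrite ≡⇒≡ᵇ≡true m≡0 =
      trans (sym val≡) (cong₂ a (Fin1-unique m≡0 idx) (Fin1-unique m≡0 last))
    ... | no m≢0 rewrite ≢⇒≡ᵇ≡false m≢0 = b₀₀≡a₀₀ m≢0
    aₘₘ≡ : (if toℕ idx ≡ᵇ m then suc (b last last) else b last last) ≡ a last last
    aₘₘ≡ with idx ≟ last
    ... | yes idx≡last rewrite ≡⇒≡ᵇ≡true (trans (cong toℕ idx≡last) (toℕ-fromℕ m)) =
      trans (cong (λ r → suc (b r last)) (sym idx≡last))
            (trans (cong suc b-at≡suc) (trans (sym val≡) (cong (λ r → a r last) idx≡last)))
    ... | no idx≢last rewrite ≢⇒≡ᵇ≡false (idx≢last ∘ ≡lastIx idx) =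
      b-off last last (idx≢last ∘ sym ∘ cong proj₁)

module DecreaseUnitVal {n m : ℕ} (A : Matrix (suc m)) (P : IsInt (suc n) (suc m) (entry A))
                       (val≡1 : val A ≡ 1) (idx<m : toℕ (index A) < m) (other : T (otherPos A)) where
  open DecreaseEntry A P public

  idx≢last : idx ≢ last
  idx≢last idx≡last = <⇒≢ idx<m (trans (cong toℕ idx≡last) (toℕ-fromℕ m))

  b-last-last : b last last ≡ a last last
  b-last-last = b-off last last (idx≢last ∘ sym ∘ cong proj₁)

  IsInt-B : IsInt n (suc m) b
  IsInt-B = IsInt-b row-idx (subst (0 <_) (sym b-last-last) a-last-last-pos)
    where
    row-idx : ∃[ j ] 0 < b idx j
    row-idx = let k , p = Equivalence.to T-anyF other in
      inject₁ k , subst (0 <_) (sym (b-off idx (inject₁ k) (fromℕ≢inject₁ ∘ sym ∘ cong proj₂))) (Equivalence.to T-pos p)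

  -- The last column of B is zero down to row index(A), so its first positive entry is further down.
  idx<index-B : toℕ idx < toℕ (index B)
  idx<index-B with IntMatrix.index-first B IsInt-B | <-cmp (toℕ (index B)) (toℕ idx)
  ... | pos , _ | tri< iB<idx _ _ = contradiction (b-above-index (index B) iB<idx) (<⇒≢ pos ∘ sym)
  ... | pos , _ | tri≈ _ iB≡idx _ =
    contradiction (trans (cong (λ r → b r last) (toℕ-injective iB≡idx)) (trans b-at (cong pred val≡1))) (<⇒≢ pos ∘ sym)
  ... | _       | tri> _ _ idx<iB = idx<iB

  step : ∀ {x} → Profile x m (toℕ (index B)) (val B) (b Fin.zero Fin.zero) (b last last) →
         Profile (x ∷ʳ toℕ idx) m (toℕ idx) (val A) (a Fin.zero Fin.zero) (a last last)
  step Q = Profile-cong refl refl (sym val≡1) (b₀₀≡a₀₀ (<⇒≢ (≤-trans (s≤s z≤n) idx<m) ∘ sym)) b-last-last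
             (Profile-descent Q idx<index-B)

inject₁-onto : ∀ {k} (j : Fin (suc k)) → j ≢ lastIx k → ∃[ j′ ] inject₁ j′ ≡ j
inject₁-onto j j≢last = lower₁ j ne , inject₁-lower₁ j ne
  where ne = λ k≡j → j≢last (≡lastIx j (sym k≡j))

module DeleteLast {n m′ : ℕ} (A : Matrix (suc (suc m′))) (P : IsInt (suc n) (suc (suc m′)) (entry A))
                  (val≡1 : val A ≡ 1) (idx≡m : toℕ (index A) ≡ suc m′) where
  open IsInt P
  open IntMatrix A P

  B = rem2 A
  b = entry B

  b≡ : ∀ r c → b r c ≡ a (inject₁ r) (inject₁ c)
  b≡ = entry-tabulate (λ r c → a (inject₁ r) (inject₁ c))

  idx≡last : idx ≡ last
  idx≡last = ≡lastIx idx idx≡m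

  a-last-last≡1 : a last last ≡ 1
  a-last-last≡1 = trans (cong (λ r → a r last) (sym idx≡last)) val≡1

  inject₁<last : ∀ r → toℕ (inject₁ r) < toℕ last
  inject₁<last r = subst₂ _<_ (sym (toℕ-inject₁ r)) (sym (toℕ-fromℕ (suc m′))) (toℕ<n r)

  last-row : ∀ c → a last (inject₁ c) ≡ 0
  last-row c = upper last (inject₁ c) (inject₁<last c)

  last-col : ∀ r → a (inject₁ r) last ≡ 0
  last-col r = above-index (inject₁ r) (subst (toℕ (inject₁ r) <_) (cong toℕ (sym idx≡last)) (inject₁<last r))

  ∑∑-a : ∑∑ a ≡ suc (∑∑ b)
  ∑∑-a = begin
    ∑ (λ r → ∑ (a r))                         ≡⟨ sum-init-last (λ r → ∑ (a r)) ⟩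
    ∑ (λ r → ∑ (a (inject₁ r))) + ∑ (a last)  ≡⟨ cong₂ _+_ (sum-cong-≗ row-sum) last-row-sum ⟩
    ∑∑ b + 1                                  ≡⟨ +-comm (∑∑ b) 1 ⟩
    suc (∑∑ b)                                ∎
    where
    open ≡-Reasoning
    row-sum : ∀ r → ∑ (a (inject₁ r)) ≡ ∑ (b r)
    row-sum r = trans (sum-init-last (a (inject₁ r)))
      (trans (cong₂ _+_ (sum-cong-≗ (λ c → sym (b≡ r c))) (last-col r)) (+-identityʳ _))
    last-row-sum : ∑ (a last) ≡ 1
    last-row-sum = trans (sum-init-last (a last)) (cong₂ _+_ (∑-zero (a last ∘ inject₁) last-row) a-last-last≡1)

  IsInt-B : IsInt n (suc m′) b
  IsInt-B = record
    { ∑∑≡    = suc-injective (trans (sym ∑∑-a) ∑∑≡)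
    ; upper  = λ r c c<r → trans (b≡ r c)
                 (upper (inject₁ r) (inject₁ c) (subst₂ _<_ (sym (toℕ-inject₁ c)) (sym (toℕ-inject₁ r)) c<r))
    ; rowPos = λ r → let c , p = rowPos (inject₁ r)
                         c′ , c′≡ = inject₁-onto c (λ c≡last →
                                      <⇒≢ p (sym (trans (cong (a (inject₁ r)) c≡last) (last-col r))))
                     in c′ , subst (0 <_) (sym (trans (b≡ r c′) (cong (a (inject₁ r)) c′≡))) p
    ; colPos = λ c → let r , p = colPos (inject₁ c)
                         r′ , r′≡ = inject₁-onto r (λ r≡last →
                                      <⇒≢ p (sym (trans (cong (λ r → a r (inject₁ c)) r≡last) (last-row c))))
                     in r′ , subst (0 <_) (sym (trans (b≡ r′ c) (cong (λ r → a r (inject₁ c)) r′≡))) p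
    }

  step : ∀ {x} → Profile x m′ (toℕ (index B)) (val B) (b Fin.zero Fin.zero) (b (lastIx m′) (lastIx m′)) →
         Profile (x ∷ʳ toℕ idx) (suc m′) (toℕ idx) (val A) (a Fin.zero Fin.zero) (a last last)
  step Q = Profile-cong refl refl (sym val≡1) (b≡ Fin.zero Fin.zero) aₘₘ≡
             (Profile-ascent Q (subst (toℕ (index B) <_) (sym idx≡m) (s≤s (toℕ≤pred[n] (index B)))) (≤-reflexive idx≡m))
    where
    aₘₘ≡ : (if toℕ idx ≡ᵇ suc m′ then 1 else b (lastIx m′) (lastIx m′)) ≡ a last last
    aₘₘ≡ rewrite ≡⇒≡ᵇ≡true idx≡m = sym a-last-last≡1

punchIn-onto : ∀ {k} (i j : Fin (suc k)) → j ≢ i → ∃[ r ] punchIn i r ≡ j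
punchIn-onto i j j≢i = punchOut (j≢i ∘ sym) , punchIn-punchOut (j≢i ∘ sym)

punchIn-mono-< : ∀ {k} (i : Fin (suc k)) (c r : Fin k) → toℕ c < toℕ r → toℕ (punchIn i c) < toℕ (punchIn i r)
punchIn-mono-< i c r c<r = ≤∧≢⇒< (punchIn-mono-≤ i c r (<⇒≤ c<r))
  (<⇒≢ c<r ∘ cong toℕ ∘ punchIn-injective i c r ∘ toℕ-injective)

toℕ≤toℕ-punchIn : ∀ {k} (i : Fin (suc k)) r → toℕ r ≤ toℕ (punchIn i r)
toℕ≤toℕ-punchIn Fin.zero     r            = n≤1+n (toℕ r)
toℕ≤toℕ-punchIn (Fin.suc i)  Fin.zero     = z≤n
toℕ≤toℕ-punchIn (Fin.suc i)  (Fin.suc r)  = s≤s (toℕ≤toℕ-punchIn i r)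

punchIn-fromℕ : ∀ {k} (i : Fin (suc (suc k))) → toℕ i ≤ k → punchIn i (fromℕ k) ≡ fromℕ (suc k)
punchIn-fromℕ         Fin.zero    _         = refl
punchIn-fromℕ {suc k} (Fin.suc i) (s≤s i≤k) = cong Fin.suc (punchIn-fromℕ i i≤k)

module DeleteIndex {n m′ : ℕ} (A : Matrix (suc (suc m′))) (P : IsInt (suc n) (suc (suc m′)) (entry A))
                   (val≡1 : val A ≡ 1) (idx<m : toℕ (index A) < suc m′) (no-other : ¬ T (otherPos A)) where
  open IsInt P
  open IntMatrix A P

  merged : Fin (suc (suc m′)) → Fin (suc (suc m′)) → ℕ
  merged r c = if eqF c last ∧ (toℕ r <ᵇ toℕ idx) then a r idx else a r c

  B = rem3 A
  b = entry B

  b≡ : ∀ r c → b r c ≡ merged (punchIn idx r) (punchIn idx c)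
  b≡ = entry-tabulate (λ r c → merged (punchIn idx r) (punchIn idx c))

  idx<last : toℕ idx < toℕ last
  idx<last = subst (toℕ idx <_) (sym (toℕ-fromℕ (suc m′))) idx<m

  idx≢last : idx ≢ last
  idx≢last = <⇒≢ idx<last ∘ cong toℕ

  row-idx : ∀ c → c ≢ last → a idx c ≡ 0
  row-idx c c≢last with c′ , refl ← inject₁-onto c c≢last | a idx (inject₁ c′) in a≡
  ... | zero  = refl
  ... | suc _ = contradiction (Equivalence.from T-anyF (c′ , Equivalence.from T-pos (subst (0 <_) (sym a≡) (s≤s z≤n)))) no-other

  a-idx-idx : a idx idx ≡ 0
  a-idx-idx = row-idx idx idx≢last

  merged-off : ∀ r c → c ≢ last → merged r c ≡ a r c
  merged-off r c c≢last = cong (λ e → if e ∧ (toℕ r <ᵇ toℕ idx) then a r idx else a r c) (dec-false (c ≟ last) c≢last)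

  -- a r idx is zero above row idx (first positive of the last column) and below it (upper triangularity).
  merged-last : ∀ r → merged r last ≡ a r idx + a r last
  merged-last r = trans (cong (λ e → if e ∧ (toℕ r <ᵇ toℕ idx) then a r idx else a r last) (dec-true (last ≟ last) refl))
                        (by-row (<-cmp (toℕ r) (toℕ idx)))
    where
    by-row : Tri (toℕ r < toℕ idx) (toℕ r ≡ toℕ idx) (toℕ idx < toℕ r) →
             (if toℕ r <ᵇ toℕ idx then a r idx else a r last) ≡ a r idx + a r last
    by-row (tri< r<idx _ _) rewrite <⇒<ᵇ≡true r<idx | above-index r r<idx = sym (+-identityʳ _)
    by-row (tri≈ _ r≡idx _) rewrite ≥⇒<ᵇ≡false (≤-reflexive (sym r≡idx)) | toℕ-injective r≡idx | a-idx-idx = refl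
    by-row (tri> _ _ idx<r) rewrite ≥⇒<ᵇ≡false (<⇒≤ idx<r) | upper r idx idx<r = refl

  merged-≥ : ∀ r c → a r c ≤ merged r c
  merged-≥ r c = by-column (c ≟ last)
    where
    by-column : Dec (c ≡ last) → a r c ≤ merged r c
    by-column (yes c≡last) = subst (λ c → a r c ≤ merged r c) (sym c≡last)
                               (subst (a r last ≤_) (sym (merged-last r)) (m≤n+m (a r last) (a r idx)))
    by-column (no c≢last)  = ≤-reflexive (sym (merged-off r c c≢last))

  merged-row-sum : ∀ r → ∑ (merged r ∘ punchIn idx) ≡ ∑ (a r)
  merged-row-sum r = +-cancelˡ-≡ (a r idx) _ _ (begin
    a r idx + ∑ (merged r ∘ punchIn idx)       ≡⟨ cong (_+ ∑ (merged r ∘ punchIn idx)) (merged-off r idx idx≢last) ⟨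
    merged r idx + ∑ (merged r ∘ punchIn idx)  ≡⟨ sum-remove {i = idx} (merged r) ⟨
    ∑ (merged r)                               ≡⟨ +-cancelʳ-≡ (a r last) _ _ added ⟩
    a r idx + ∑ (a r)                          ∎)
    where
    open ≡-Reasoning
    added : ∑ (merged r) + a r last ≡ (a r idx + ∑ (a r)) + a r last
    added = begin
      ∑ (merged r) + a r last          ≡⟨ ∑-update (a r) (merged r) last (λ c c≢last → sym (merged-off r c c≢last)) ⟩
      ∑ (a r) + merged r last          ≡⟨ cong (∑ (a r) +_) (merged-last r) ⟩
      ∑ (a r) + (a r idx + a r last)   ≡⟨ rearrange (∑ (a r)) (a r idx) (a r last) ⟩
      (a r idx + ∑ (a r)) + a r last   ∎
      where
      rearrange : ∀ x y z → x + (y + z) ≡ (y + x) + z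
      rearrange = solve-∀

  ∑∑-a : ∑∑ a ≡ suc (∑∑ b)
  ∑∑-a = begin
    ∑ (λ r → ∑ (a r))                                  ≡⟨ sum-cong-≗ (sym ∘ merged-row-sum) ⟩
    ∑ (λ r → ∑ (merged r ∘ punchIn idx))               ≡⟨ sum-remove {i = idx} (λ r → ∑ (merged r ∘ punchIn idx)) ⟩
    ∑ (merged idx ∘ punchIn idx) + ∑ (λ r → ∑ (merged (punchIn idx r) ∘ punchIn idx))
                                                       ≡⟨ cong₂ _+_ (trans (merged-row-sum idx) row-idx-sum)
                                                                    (sum-cong-≗ (λ r → sum-cong-≗ (sym ∘ b≡ r))) ⟩
    suc (∑∑ b)                                         ∎
    where
    open ≡-Reasoning
    row-idx-sum : ∑ (a idx) ≡ 1
    row-idx-sum = trans (sum-remove {i = last} (a idx))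
      (cong₂ _+_ val≡1 (∑-zero _ (λ c → row-idx (punchIn last c) (punchInᵢ≢i last c))))

  last≢idx : last ≢ idx
  last≢idx = idx≢last ∘ sym

  IsInt-B : IsInt n (suc m′) b
  IsInt-B = record
    { ∑∑≡    = suc-injective (trans (sym ∑∑-a) ∑∑≡)
    ; upper  = upper-b
    ; rowPos = row
    ; colPos = col
    }
    where
    upper-b : ∀ r c → toℕ c < toℕ r → b r c ≡ 0
    upper-b r c c<r with punchIn idx c ≟ last
    ... | yes c′≡last = contradiction (toℕ≤pred[n] (punchIn idx r))
            (<⇒≱ (subst (_< toℕ (punchIn idx r)) (trans (cong toℕ c′≡last) (toℕ-fromℕ (suc m′)))
                        (punchIn-mono-< idx c r c<r)))
    ... | no c′≢last = trans (b≡ r c) (trans (merged-off _ _ c′≢last) (upper _ _ (punchIn-mono-< idx c r c<r)))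
    row : ∀ r → ∃[ c ] 0 < b r c
    row r with rowPos (punchIn idx r)
    ... | c , p with c ≟ idx
    ...   | no c≢idx = let c′ , c′≡ = punchIn-onto idx c c≢idx in
            c′ , subst (0 <_) (sym (trans (b≡ r c′) (cong (merged (punchIn idx r)) c′≡))) (≤-trans p (merged-≥ _ c))
    ...   | yes c≡idx = let c′ , c′≡ = punchIn-onto idx last last≢idx in
            c′ , subst (0 <_) (sym (trans (b≡ r c′) (trans (cong (merged (punchIn idx r)) c′≡) (merged-last _))))
                   (≤-trans (subst (λ c → 0 < a (punchIn idx r) c) c≡idx p) (m≤m+n _ _))
    col : ∀ c → ∃[ r ] 0 < b r c
    col c with punchIn idx c ≟ last
    ... | yes c′≡last = let r′ , r′≡ = punchIn-onto idx last last≢idx in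
            r′ , subst (0 <_) (sym (trans (b≡ r′ c) (cong₂ merged r′≡ c′≡last)))
                   (≤-trans a-last-last-pos (merged-≥ last last))
    ... | no c′≢last with colPos (punchIn idx c)
    ...   | r , p =
      let r′ , r′≡ = punchIn-onto idx r (λ r≡idx →
                       <⇒≢ p (sym (trans (cong (λ r → a r (punchIn idx c)) r≡idx) (row-idx _ c′≢last))))
      in r′ , subst (0 <_) (sym (trans (b≡ r′ c) (cong (λ r → merged r (punchIn idx c)) r′≡))) (≤-trans p (merged-≥ r _))

  -- Column idx of A is non-zero only above row idx, and that entry moves into B's last column.
  index-B<idx : toℕ (index B) < toℕ idx
  index-B<idx with colPos idx
  ... | r , p = ≤-<-trans (IsFirstPositive-≤ (IntMatrix.index-first B IsInt-B) r′ b-r′-last-pos)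
                  (≤-<-trans (toℕ≤toℕ-punchIn idx r′) (subst (λ r → toℕ r < toℕ idx) (sym r′≡) r<idx))
    where
    r≢idx : r ≢ idx
    r≢idx r≡idx = <⇒≢ p (sym (trans (cong (λ r → a r idx) r≡idx) a-idx-idx))
    r<idx : toℕ r < toℕ idx
    r<idx with <-cmp (toℕ r) (toℕ idx)
    ... | tri< r<idx _ _ = r<idx
    ... | tri≈ _ r≡idx _ = contradiction (toℕ-injective r≡idx) r≢idx
    ... | tri> _ _ idx<r = contradiction (upper r idx idx<r) (<⇒≢ p ∘ sym)
    r′ = proj₁ (punchIn-onto idx r r≢idx)
    r′≡ = proj₂ (punchIn-onto idx r r≢idx)
    b-r′-last-pos : 0 < b r′ (lastIx m′)
    b-r′-last-pos = subst (0 <_)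
      (sym (trans (b≡ r′ (lastIx m′)) (trans (cong₂ merged r′≡ (punchIn-fromℕ idx (≤-pred idx<m))) (merged-last r))))
      (≤-trans p (m≤m+n _ _))

  step : ∀ {x} → Profile x m′ (toℕ (index B)) (val B) (b Fin.zero Fin.zero) (b (lastIx m′) (lastIx m′)) →
         Profile (x ∷ʳ toℕ idx) (suc m′) (toℕ idx) (val A) (a Fin.zero Fin.zero) (a last last)
  step Q = Profile-cong refl refl (sym val≡1) b₀₀≡ aₘₘ≡ (Profile-ascent Q index-B<idx (<⇒≤ idx<m))
    where
    idx≢0 : idx ≢ Fin.zero
    idx≢0 idx≡0 = contradiction (trans (cong (λ r → a r Fin.zero) (sym idx≡0)) (row-idx Fin.zero (last≢zero (λ ()) ∘ sym)))
                    (<⇒≢ a₀₀-pos ∘ sym)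
    punchIn-zero : ∀ {k} (i : Fin (suc (suc k))) → i ≢ Fin.zero → punchIn i Fin.zero ≡ Fin.zero
    punchIn-zero Fin.zero    i≢0 = contradiction refl i≢0
    punchIn-zero (Fin.suc i) _   = refl
    b₀₀≡ : b Fin.zero Fin.zero ≡ a Fin.zero Fin.zero
    b₀₀≡ = trans (b≡ Fin.zero Fin.zero) (trans (cong₂ merged (punchIn-zero idx idx≢0) (punchIn-zero idx idx≢0))
             (merged-off Fin.zero Fin.zero (last≢zero (λ ()) ∘ sym)))
    aₘₘ≡ : (if toℕ idx ≡ᵇ suc m′ then 1 else b (lastIx m′) (lastIx m′)) ≡ a last last
    aₘₘ≡ rewrite ≢⇒≡ᵇ≡false (<⇒≢ idx<m) =
      trans (b≡ _ _) (trans (cong₂ merged last′≡ last′≡)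
        (trans (merged-last last) (cong (_+ a last last) (upper last idx idx<last))))
      where last′≡ = punchIn-fromℕ idx (≤-pred idx<m)

ProfileOf : ∀ {m} → List ℕ → Matrix (suc m) → Set
ProfileOf {m} x A = Profile x m (toℕ (index A)) (val A) (entry A Fin.zero Fin.zero) (entry A (lastIx m) (lastIx m))

ProfileOf-Γ′-step : ∀ k {m} (A : Matrix (suc m)) {d B} → f A ≡ (d , B) →
  ProfileOf (Γ' (suc k) d B ∷ʳ toℕ (index A)) A → ProfileOf (Γ' (suc (suc k)) (suc m) A) A
ProfileOf-Γ′-step k A f≡ = subst (λ x → ProfileOf x A) (cong (λ (d , B) → Γ' (suc k) d B ∷ʳ toℕ (index A)) (sym f≡))

module OneByOne {n} (A : Matrix 1) (P : IsInt n 1 (entry A)) where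
  index≡0 : index A ≡ Fin.zero
  index≡0 = Fin1-unique refl (index A)

  a₀₀≡n : entry A Fin.zero Fin.zero ≡ n
  a₀₀≡n = trans (sym (trans (+-identityʳ _) (+-identityʳ _))) (IsInt.∑∑≡ P)

  val≡n : val A ≡ n
  val≡n = trans (cong (λ r → entry A r Fin.zero) index≡0) a₀₀≡n

Γ-profile : ∀ k m (A : Matrix (suc m)) → IsInt (suc k) (suc m) (entry A) → ProfileOf (Γ' (suc k) (suc m) A) A
Γ-profile zero m A P with IsInt⇒dim≤n P
Γ-profile zero zero A P | _ =
  Profile-cong refl (cong toℕ (sym index≡0)) (sym val≡n) (sym a₀₀≡n) (sym a₀₀≡n) Profile-singleton
  where open OneByOne A P
Γ-profile zero (suc m) A P | s≤s ()
Γ-profile (suc k) m A P with removal A (IntMatrix.val-pos A P)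
... | decreaseLarge v₀ val≡ f≡ = ProfileOf-Γ′-step k A f≡ (step (Γ-profile k m B IsInt-B))
  where open DecreaseLargeVal A P v₀ val≡
... | decreaseUnit val≡1 idx<m other f≡ = ProfileOf-Γ′-step k A f≡ (step (Γ-profile k m B IsInt-B))
  where open DecreaseUnitVal A P val≡1 idx<m other
Γ-profile (suc k) zero A P | deleteLast val≡1 _ _ =
  contradiction (trans (sym val≡1) (OneByOne.val≡n A P)) λ ()
Γ-profile (suc k) (suc m′) A P | deleteLast val≡1 idx≡m f≡ =
  ProfileOf-Γ′-step k A f≡ (step (Γ-profile k m′ B IsInt-B))
  where open DeleteLast A P val≡1 idx≡m
Γ-profile (suc k) zero A P | deleteIndex _ () _ _
Γ-profile (suc k) (suc m′) A P | deleteIndex val≡1 idx<m no-other f≡ =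
  ProfileOf-Γ′-step k A f≡ (step (Γ-profile k m′ B IsInt-B))
  where open DeleteIndex A P val≡1 idx<m no-other

Γ-run-statistics : ∀ n → 1 ≤ n → ∀ m (A : Matrix (suc m)) → T (isInt n A) →
    (entry A Fin.zero Fin.zero ≡ firstRunLen (Γ n A))
  × (val A ≡ lastRunLen (Γ n A))
  × (entry A (lastIx m) (lastIx m) ≡ lastQualRunLen (Γ n A))
Γ-run-statistics (suc k) _ m A A∈Int =
  sym firstRunLen≡ , sym (trans (cong lastLen runs≡) (lastLen-∷ʳ initRuns _ _)) , sym lastQualRunLen≡
  where open Profile (Γ-profile k m A (Equivalence.to (isInt⇔IsInt (suc k) A) A∈Int))

Position : ℕ → Set
Position d = Fin d × Fin d

_≟ᴾ_ : ∀ {d} (p q : Position d) → Dec (p ≡ q)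
_≟ᴾ_ = ≡-dec _≟_ _≟_

at : ∀ {d} → (Fin d → Fin d → ℕ) → Position d → ℕ
at a p = a (proj₁ p) (proj₂ p)

update : ∀ {d} → (Fin d → Fin d → ℕ) → Position d → ℕ → Fin d → Fin d → ℕ
update a p w r c = if does ((r , c) ≟ᴾ p) then w else a r c

update-≡ : ∀ {d} (a : Fin d → Fin d → ℕ) {p w r c} → (r , c) ≡ p → update a p w r c ≡ w
update-≡ a {p} {w} {r} {c} rc≡p = cong (if_then w else a r c) (dec-true ((r , c) ≟ᴾ p) rc≡p)

update-≢ : ∀ {d} (a : Fin d → Fin d → ℕ) {p w r c} → (r , c) ≢ p → update a p w r c ≡ a r c
update-≢ a {p} {w} {r} {c} rc≢p = cong (if_then w else a r c) (dec-false ((r , c) ≟ᴾ p) rc≢p)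

update-own : ∀ {d} (a : Fin d → Fin d → ℕ) p q → at (update a p (at a q)) q ≡ at a q
update-own a p q = by-cases (q ≟ᴾ p)
  where
  by-cases : Dec (q ≡ p) → at (update a p (at a q)) q ≡ at a q
  by-cases (yes q≡p) = update-≡ a q≡p
  by-cases (no  q≢p) = update-≢ a q≢p

swap : ∀ {d} → (Fin d → Fin d → ℕ) → Position d → Position d → Fin d → Fin d → ℕ
swap a p q = update (update a p (at a q)) q (at a p)

module _ {d} (a : Fin d → Fin d → ℕ) {p q : Position d} where

  swap-≡q : ∀ r c → (r , c) ≡ q → swap a p q r c ≡ at a p
  swap-≡q r c = update-≡ (update a p (at a q))

  swap-≡p : ∀ r c → (r , c) ≡ p → swap a p q r c ≡ at a q
  swap-≡p r c rc≡p = by-cases ((r , c) ≟ᴾ q)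
    where
    by-cases : Dec ((r , c) ≡ q) → swap a p q r c ≡ at a q
    by-cases (yes rc≡q) = trans (swap-≡q r c rc≡q) (cong (at a) (trans (sym rc≡p) rc≡q))
    by-cases (no  rc≢q) = trans (update-≢ (update a p (at a q)) rc≢q) (update-≡ a rc≡p)

  swap-≢ : ∀ {r c} → (r , c) ≢ p → (r , c) ≢ q → swap a p q r c ≡ a r c
  swap-≢ rc≢p rc≢q = trans (update-≢ (update a p (at a q)) rc≢q) (update-≢ a rc≢p)

  swap-pos : 0 < at a p → 0 < at a q → ∀ r c → 0 < a r c → 0 < swap a p q r c
  swap-pos p-pos q-pos r c rc-pos = by-cases ((r , c) ≟ᴾ q) ((r , c) ≟ᴾ p)
    where
    by-cases : Dec ((r , c) ≡ q) → Dec ((r , c) ≡ p) → 0 < swap a p q r c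
    by-cases (yes rc≡q) _          = subst (0 <_) (sym (swap-≡q r c rc≡q)) p-pos
    by-cases (no  _)    (yes rc≡p) = subst (0 <_) (sym (swap-≡p r c rc≡p)) q-pos
    by-cases (no  rc≢q) (no rc≢p)  = subst (0 <_) (sym (swap-≢ rc≢p rc≢q)) rc-pos

  ∑∑-swap : ∑∑ (swap a p q) ≡ ∑∑ a
  ∑∑-swap = +-cancelʳ-≡ (at a q) _ _ (begin
    ∑∑ (swap a p q) + at a q  ≡⟨ cong (∑∑ (swap a p q) +_) (update-own a p q) ⟨
    ∑∑ (swap a p q) + at u q  ≡⟨ ∑∑-update u (swap a p q) (proj₁ q) (proj₂ q) (λ r c rc≢q → sym (update-≢ u rc≢q)) ⟩
    ∑∑ u + at (swap a p q) q  ≡⟨ cong (∑∑ u +_) (swap-≡q (proj₁ q) (proj₂ q) refl) ⟩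
    ∑∑ u + at a p             ≡⟨ ∑∑-update a u (proj₁ p) (proj₂ p) (λ r c rc≢p → sym (update-≢ a rc≢p)) ⟩
    ∑∑ a + at u p             ≡⟨ cong (∑∑ a +_) (update-≡ a {r = proj₁ p} {proj₂ p} refl) ⟩
    ∑∑ a + at a q             ∎)
    where
    open ≡-Reasoning
    u = update a p (at a q)

swap-involutive : ∀ {d} (a b : Fin d → Fin d → ℕ) {p q} → (∀ r c → b r c ≡ swap a p q r c) →
  ∀ r c → swap b p q r c ≡ a r c
swap-involutive a b {p} {q} b≡ r c = by-cases ((r , c) ≟ᴾ q) ((r , c) ≟ᴾ p)
  where
  by-cases : Dec ((r , c) ≡ q) → Dec ((r , c) ≡ p) → swap b p q r c ≡ a r c
  by-cases (yes rc≡q) _ =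
    trans (swap-≡q b r c rc≡q) (trans (b≡ (proj₁ p) (proj₂ p))
      (trans (swap-≡p a (proj₁ p) (proj₂ p) refl) (cong (at a) (sym rc≡q))))
  by-cases (no  rc≢q) (yes rc≡p) =
    trans (swap-≡p b r c rc≡p) (trans (b≡ (proj₁ q) (proj₂ q))
      (trans (swap-≡q a (proj₁ q) (proj₂ q) refl) (cong (at a) (sym rc≡p))))
  by-cases (no  rc≢q) (no  rc≢p) = trans (swap-≢ b rc≢p rc≢q) (trans (b≡ r c) (swap-≢ a rc≢p rc≢q))

OnOrAboveDiagonal : ∀ {d} → Position d → Set
OnOrAboveDiagonal (r , c) = toℕ r ≤ toℕ c

IsInt-swap : ∀ {n d} {a : Fin d → Fin d → ℕ} {p q} → OnOrAboveDiagonal p → OnOrAboveDiagonal q →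
  0 < at a p → 0 < at a q → IsInt n d a → IsInt n d (swap a p q)
IsInt-swap {a = a} {p} {q} p-upper q-upper p-pos q-pos P = record
  { ∑∑≡    = trans (∑∑-swap a) ∑∑≡
  ; upper  = λ r c c<r → trans (swap-≢ a (below p-upper c<r) (below q-upper c<r)) (upper r c c<r)
  ; rowPos = λ r → let c , rc-pos = rowPos r in c , swap-pos a p-pos q-pos r c rc-pos
  ; colPos = λ c → let r , rc-pos = colPos c in r , swap-pos a p-pos q-pos r c rc-pos
  }
  where
  open IsInt P
  below : ∀ {x r c} → OnOrAboveDiagonal x → toℕ c < toℕ r → (r , c) ≢ x
  below x-upper c<r refl = <⇒≱ c<r x-upper

swapM : ∀ {d} → Matrix d → Position d → Position d → Matrix d
swapM A p q = Vec.tabulate λ r → Vec.tabulate (swap (entry A) p q r)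

entry-swapM : ∀ {d} (A : Matrix d) p q r c → entry (swapM A p q) r c ≡ swap (entry A) p q r c
entry-swapM A p q = entry-tabulate (swap (entry A) p q)

Matrix-ext : ∀ {d} {A B : Matrix d} → (∀ r c → entry A r c ≡ entry B r c) → A ≡ B
Matrix-ext {A = A} {B} A≡B = trans (sym (tabulate-entry A)) (trans (tabulate-cong (λ r → tabulate-cong (A≡B r))) (tabulate-entry B))
  where
  tabulate-entry : ∀ A → Vec.tabulate (λ r → Vec.tabulate (entry A r)) ≡ A
  tabulate-entry A = trans (tabulate-cong (λ r → tabulate∘lookup (Vec.lookup A r))) (tabulate∘lookup A)

swapM-involutive : ∀ {d} (A : Matrix d) p q → swapM (swapM A p q) p q ≡ A
swapM-involutive A p q = Matrix-ext λ r c →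
  trans (entry-swapM (swapM A p q) p q r c) (swap-involutive (entry A) (entry (swapM A p q)) (entry-swapM A p q) r c)

isInt-swapM : ∀ {n d} (A : Matrix d) {p q} → OnOrAboveDiagonal p → OnOrAboveDiagonal q →
  0 < at (entry A) p → 0 < at (entry A) q → T (isInt n A) → T (isInt n (swapM A p q))
isInt-swapM {n} A {p} {q} p-upper q-upper p-pos q-pos A∈Int = Equivalence.from (isInt⇔IsInt n (swapM A p q))
  (IsInt-cong (λ r c → sym (entry-swapM A p q r c))
    (IsInt-swap p-upper q-upper p-pos q-pos (Equivalence.to (isInt⇔IsInt n A) A∈Int)))

MatrixStatistic : Set
MatrixStatistic = Σ ℕ (λ m → Matrix (suc m)) → ℕ

record StatisticSwap (n : ℕ) (s₁ s₂ : MatrixStatistic) : Set where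
  field
    σ            : ∀ {m} → Matrix (suc m) → Matrix (suc m)
    σ-isInt      : ∀ {m} (A : Matrix (suc m)) → T (isInt n A) → T (isInt n (σ A))
    σ-involutive : ∀ {m} (A : Matrix (suc m)) → T (isInt n A) → σ (σ A) ≡ A
    s₂∘σ         : ∀ {m} (A : Matrix (suc m)) → T (isInt n A) → s₂ (m , σ A) ≡ s₁ (m , A)

IntFibre-≡ : ∀ {n s k m} {A B : Matrix (suc m)} {A∈ B∈ sA≡ sB≡} → A ≡ B →
  _≡_ {A = IntFibre n s k} ((m , A , A∈) , sA≡) ((m , B , B∈) , sB≡)
IntFibre-≡ refl = cong₂ (λ A∈ sA≡ → ((_ , _ , A∈) , sA≡)) (T-irrelevant _ _) (≡-irrelevant _ _)

IntFibre-↔ : ∀ {n s₁ s₂} → StatisticSwap n s₁ s₂ → ∀ k → IntFibre n s₁ k ↔ IntFibre n s₂ k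
IntFibre-↔ {n} {s₁} {s₂} S k =
  mk↔ₛ′ (apply s₂∘σ) (apply s₁∘σ) (apply²≡id s₁∘σ s₂∘σ) (apply²≡id s₂∘σ s₁∘σ)
  where
  open StatisticSwap S
  Carries : MatrixStatistic → MatrixStatistic → Set
  Carries t t′ = ∀ {m} (A : Matrix (suc m)) → T (isInt n A) → t′ (m , σ A) ≡ t (m , A)
  s₁∘σ : Carries s₂ s₁
  s₁∘σ A A∈ = trans (sym (s₂∘σ (σ A) (σ-isInt A A∈))) (cong (λ B → s₂ (_ , B)) (σ-involutive A A∈))
  apply : ∀ {t t′} → Carries t t′ → IntFibre n t k → IntFibre n t′ k
  apply e ((m , A , A∈) , tA≡k) = (m , σ A , σ-isInt A A∈) , trans (e A A∈) tA≡k
  apply²≡id : ∀ {t t′} (e : Carries t t′) (e′ : Carries t′ t) y → apply e′ (apply e y) ≡ y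
  apply²≡id e e′ ((m , A , A∈) , _) = IntFibre-≡ (σ-involutive A A∈)

origin : ∀ {m} → Position (suc m)
origin = Fin.zero , Fin.zero

swapCorners : ∀ n → StatisticSwap n topLeft botRight
swapCorners n = record
  { σ            = σ
  ; σ-isInt      = λ A A∈ → let open IntMatrix A (Equivalence.to (isInt⇔IsInt n A) A∈) in
                     isInt-swapM A z≤n ≤-refl a₀₀-pos a-last-last-pos A∈
  ; σ-involutive = λ {m} A _ → swapM-involutive A origin (corner m)
  ; s₂∘σ         = λ {m} A _ → trans (entry-swapM A origin (corner m) (lastIx m) (lastIx m))
                                  (swap-≡q (entry A) (lastIx m) (lastIx m) refl)
  }
  where
  corner : ∀ m → Position (suc m)
  corner m = lastIx m , lastIx m
  σ : ∀ {m} → Matrix (suc m) → Matrix (suc m)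
  σ {m} A = swapM A origin (corner m)

-- Exchanging A₁₁ with val(A) leaves index(A) unchanged, since both entries are positive.
swapCornerVal : ∀ n → StatisticSwap n topLeft valS
swapCornerVal n = record
  { σ            = σ
  ; σ-isInt      = σ-isInt
  ; σ-involutive = λ {m} A A∈ → trans (cong (λ i → swapM (σ A) origin (i , lastIx m)) (index-σ A A∈))
                                  (swapM-involutive A origin (valPosition A))
  ; s₂∘σ         = λ {m} A A∈ → trans (cong (λ i → entry (σ A) i (lastIx m)) (index-σ A A∈)) (σ-at-val A)
  }
  where
  valPosition : ∀ {m} → Matrix (suc m) → Position (suc m)
  valPosition {m} A = index A , lastIx m
  σ : ∀ {m} → Matrix (suc m) → Matrix (suc m)
  σ A = swapM A origin (valPosition A)
  σ-at-val : ∀ {m} (A : Matrix (suc m)) → entry (σ A) (index A) (lastIx m) ≡ entry A Fin.zero Fin.zero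
  σ-at-val {m} A = trans (entry-swapM A origin (valPosition A) (index A) (lastIx m))
                         (swap-≡q (entry A) (index A) (lastIx m) refl)
  σ-isInt : ∀ {m} (A : Matrix (suc m)) → T (isInt n A) → T (isInt n (σ A))
  σ-isInt {m} A A∈ = isInt-swapM A z≤n (subst (toℕ (index A) ≤_) (sym (toℕ-fromℕ m)) (toℕ≤pred[n] (index A)))
                       a₀₀-pos val-pos A∈
    where open IntMatrix A (Equivalence.to (isInt⇔IsInt n A) A∈)
  index-σ : ∀ {m} (A : Matrix (suc m)) → T (isInt n A) → index (σ A) ≡ index A
  index-σ {m} A A∈ = IsFirstPositive-unique (IntMatrix.index-first (σ A) (Equivalence.to (isInt⇔IsInt n (σ A)) (σ-isInt A A∈)))
    (subst (0 <_) (sym (σ-at-val A)) a₀₀-pos , above)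
    where
    open IntMatrix A (Equivalence.to (isInt⇔IsInt n A) A∈)
    above : ∀ r → toℕ r < toℕ (index A) → entry (σ A) r (lastIx m) ≡ 0
    above r r<idx = trans (entry-swapM A origin (valPosition A) r (lastIx m))
                      (trans (swap-≢ (entry A) rc≢origin (<⇒≢ r<idx ∘ cong (toℕ ∘ proj₁))) (above-index r r<idx))
      where
      rc≢origin : (r , lastIx m) ≢ origin
      rc≢origin rc≡origin with ≤-trans r<idx (subst (toℕ (index A) ≤_)
                                 (trans (sym (toℕ-fromℕ m)) (cong (toℕ ∘ proj₂) rc≡origin)) (toℕ≤pred[n] (index A)))
      ... | ()

fromRuns : List (ℕ × ℕ) → List ℕ
fromRuns []            = []
fromRuns ((v , l) ∷ R) = replicate l v ++ fromRuns R

values : List (ℕ × ℕ) → List ℕ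
values = map proj₁

record IsRunList (R : List (ℕ × ℕ)) : Set where
  field
    positive    : All (λ r → 0 < proj₂ r) R
    alternating : Linked _≢_ (values R)

fromRuns-consRun : ∀ a R → fromRuns (consRun a R) ≡ a ∷ fromRuns R
fromRuns-consRun a []            = refl
fromRuns-consRun a ((b , k) ∷ R) with a ≡ᵇ b in a≡ᵇb
... | true  rewrite ≡ᵇ⇒≡ a b (≡true⇒T a≡ᵇb) = refl
... | false = refl

fromRuns-runs : ∀ x → fromRuns (runs x) ≡ x
fromRuns-runs []       = refl
fromRuns-runs (a ∷ xs) =
  trans (cong fromRuns (runs-∷ a xs)) (trans (fromRuns-consRun a (runs xs)) (cong (a ∷_) (fromRuns-runs xs)))

IsRunList-consRun : ∀ a {R} → IsRunList R → IsRunList (consRun a R)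
IsRunList-consRun a {[]}            _ = record { positive = s≤s z≤n ∷ [] ; alternating = [-] }
IsRunList-consRun a {(b , k) ∷ R′} IR with a ≡ᵇ b in a≡ᵇb
... | true  = record { positive = s≤s z≤n ∷ All.tail positive ; alternating = alternating }
  where open IsRunList IR
... | false = record { positive = s≤s z≤n ∷ positive
                     ; alternating = (λ a≡b → subst T a≡ᵇb (≡⇒≡ᵇ a b a≡b)) ∷ alternating }
  where open IsRunList IR

IsRunList-runs : ∀ x → IsRunList (runs x)
IsRunList-runs []       = record { positive = [] ; alternating = [] }
IsRunList-runs (a ∷ xs) = subst IsRunList (sym (runs-∷ a xs)) (IsRunList-consRun a (IsRunList-runs xs))

runs-fromRuns : ∀ R → IsRunList R → runs (fromRuns R) ≡ R
runs-fromRuns []                   _  = refl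
runs-fromRuns ((v , zero) ∷ R′)    IR with IsRunList.positive IR
... | () ∷ _
runs-fromRuns ((v , suc l) ∷ R′) IR =
  runs-replicate l (runs-fromRuns R′ (record { positive = All.tail positive ; alternating = Linked.tail alternating }))
  where
  open IsRunList IR
  runs-replicate : ∀ l → runs (fromRuns R′) ≡ R′ → runs (replicate (suc l) v ++ fromRuns R′) ≡ (v , suc l) ∷ R′
  runs-replicate zero    runs≡ = trans (runs-∷ v (fromRuns R′)) (trans (cong (consRun v) runs≡) (first-run R′ alternating))
    where
    first-run : ∀ R → Linked _≢_ (v ∷ values R) → consRun v R ≡ (v , 1) ∷ R
    first-run []            _           = refl
    first-run ((w , k) ∷ R) (v≢w ∷ _) rewrite ≢⇒≡ᵇ≡false v≢w = refl
  runs-replicate (suc l) runs≡ rewrite runs-∷ v (replicate (suc l) v ++ fromRuns R′) | runs-replicate l runs≡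
                                     | ≡⇒≡ᵇ≡true {v} refl = refl

length-fromRuns : ∀ R → length (fromRuns R) ≡ totalLength R
length-fromRuns []            = refl
length-fromRuns ((v , l) ∷ R) =
  trans (length-++ (replicate l v)) (cong₂ _+_ (length-replicate l) (length-fromRuns R))

-- Ascent sequences, read left to right: c counts the ascents so far, p is the previous entry.

ascentsOK : ℕ → ℕ → List ℕ → Bool
ascentsOK c p []       = true
ascentsOK c p (b ∷ xs) = (b ≤ᵇ suc c) ∧ ascentsOK (c + ascent p b) b xs

isAscentSeq : List ℕ → Bool
isAscentSeq []       = true
isAscentSeq (a ∷ xs) = (a ≡ᵇ 0) ∧ ascentsOK 0 a xs

all-tabulate≡ascentsOK : ∀ c p xs {A : Set} (P : A → Bool) (g : Fin (length xs) → A) →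
  (∀ j → P (g j) ≡ (lookup xs j ≤ᵇ suc (c + asc (p ∷ take (toℕ j) xs)))) →
  all P (List.tabulate g) ≡ ascentsOK c p xs
all-tabulate≡ascentsOK c p []       P g P≡ = refl
all-tabulate≡ascentsOK c p (b ∷ xs) P g P≡ =
  cong₂ _∧_ (trans (P≡ Fin.zero) (cong (λ t → b ≤ᵇ suc t) (+-identityʳ c)))
            (all-tabulate≡ascentsOK (c + ascent p b) b xs P (g ∘ Fin.suc)
              (λ j → trans (P≡ (Fin.suc j))
                 (cong (λ t → lookup xs j ≤ᵇ suc t) (sym (+-assoc c (ascent p b) (asc (b ∷ take (toℕ j) xs)))))))

isAsc≡ : ∀ n x → isAsc n x ≡ (length x ≡ᵇ n) ∧ isAscentSeq x
isAsc≡ n []       = refl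
isAsc≡ n (a ∷ xs) = cong ((suc (length xs) ≡ᵇ n) ∧_)
  (cong₂ _∧_ (∨-identityʳ (a ≡ᵇ 0)) (all-tabulate≡ascentsOK 0 a xs _ Fin.suc (λ _ → refl)))

-- Repeating an entry neither adds an ascent nor violates the bound it already met.
ascentsOK-replicate : ∀ c v l E → v ≤ suc c → ascentsOK c v (replicate l v ++ E) ≡ ascentsOK c v E
ascentsOK-replicate c v zero    E v≤ = refl
ascentsOK-replicate c v (suc l) E v≤ rewrite T⇒≡true (≤⇒≤ᵇ v≤) | ascent-≥ {v} ≤-refl | +-identityʳ c =
  ascentsOK-replicate c v l E v≤

ascentsOK-fromRuns : ∀ c p R → All (λ r → 0 < proj₂ r) R → ascentsOK c p (fromRuns R) ≡ ascentsOK c p (values R)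
ascentsOK-fromRuns c p []                 _           = refl
ascentsOK-fromRuns c p ((v , suc l) ∷ R) (_ ∷ pos) with v ≤ᵇ suc c in v≤ᵇ
... | false = refl
... | true  = trans (ascentsOK-replicate (c + ascent p v) v l _
                      (≤-trans (≤ᵇ⇒≤ v (suc c) (≡true⇒T v≤ᵇ)) (s≤s (m≤m+n c _))))
                    (ascentsOK-fromRuns (c + ascent p v) v R pos)

isAsc-fromRuns : ∀ n R → All (λ r → 0 < proj₂ r) R →
  isAsc n (fromRuns R) ≡ (totalLength R ≡ᵇ n) ∧ isAscentSeq (values R)
isAsc-fromRuns n R pos = trans (isAsc≡ n (fromRuns R)) (cong₂ _∧_ (cong (_≡ᵇ n) (length-fromRuns R)) (isAscentSeq-fromRuns R pos))
  where
  isAscentSeq-fromRuns : ∀ R → All (λ r → 0 < proj₂ r) R → isAscentSeq (fromRuns R) ≡ isAscentSeq (values R)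
  isAscentSeq-fromRuns []                 _         = refl
  isAscentSeq-fromRuns ((v , suc l) ∷ R) (_ ∷ pos) with v ≡ᵇ 0 in v≡ᵇ0
  ... | false = refl
  ... | true rewrite ≡ᵇ⇒≡ v 0 (≡true⇒T v≡ᵇ0) =
    trans (ascentsOK-replicate 0 0 l _ z≤n) (ascentsOK-fromRuns 0 0 R pos)

lengthAt : ℕ → List (ℕ × ℕ) → ℕ
lengthAt j       []            = 0
lengthAt zero    ((_ , l) ∷ R) = l
lengthAt (suc j) (_ ∷ R)       = lengthAt j R

firstRunLen-fromRuns : ∀ R → IsRunList R → firstRunLen (fromRuns R) ≡ lengthAt 0 R
firstRunLen-fromRuns R IR = trans (firstRunLen≡headLength (fromRuns R)) (trans (cong headLength (runs-fromRuns R IR)) (head≡ R))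
  where
  head≡ : ∀ R → headLength R ≡ lengthAt 0 R
  head≡ []      = refl
  head≡ (_ ∷ _) = refl

lastRunLen-fromRuns : ∀ R → IsRunList R → lastRunLen (fromRuns R) ≡ lengthAt (length (values R) ∸ 1) R
lastRunLen-fromRuns R IR =
  trans (cong lastLen (runs-fromRuns R IR)) (trans (last≡ R) (cong (λ t → lengthAt (t ∸ 1) R) (sym (length-map proj₁ R))))
  where
  last≡ : ∀ R → lastLen R ≡ lengthAt (length R ∸ 1) R
  last≡ []           = refl
  last≡ (_ ∷ [])     = refl
  last≡ (_ ∷ r ∷ R) = last≡ (r ∷ R)

asc-replicate : ∀ v l E → asc (v ∷ replicate l v ++ E) ≡ asc (v ∷ E)
asc-replicate v zero    E = refl
asc-replicate v (suc l) E = trans (cong (_+ asc (v ∷ replicate l v ++ E)) (ascent-≥ {v} ≤-refl)) (asc-replicate v l E)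

asc-∷-fromRuns : ∀ p R → All (λ r → 0 < proj₂ r) R → asc (p ∷ fromRuns R) ≡ asc (p ∷ values R)
asc-∷-fromRuns p []                 _         = refl
asc-∷-fromRuns p ((w , suc k) ∷ R) (_ ∷ pos) =
  cong (ascent p w +_) (trans (asc-replicate w k (fromRuns R)) (asc-∷-fromRuns w R pos))

asc-fromRuns : ∀ R → All (λ r → 0 < proj₂ r) R → asc (fromRuns R) ≡ asc (values R)
asc-fromRuns []                  _         = refl
asc-fromRuns ((v , suc l) ∷ R)  (_ ∷ pos) = trans (asc-replicate v l (fromRuns R)) (asc-∷-fromRuns v R pos)

fromRuns-++ : ∀ P Q → fromRuns (P ++ Q) ≡ fromRuns P ++ fromRuns Q
fromRuns-++ []            Q = refl
fromRuns-++ ((v , l) ∷ P) Q = trans (cong (replicate l v ++_) (fromRuns-++ P Q)) (sym (++-assoc (replicate l v) _ _))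

qualifiesAt : List ℕ → ℕ → ℕ → Bool
qualifiesAt vs t v = (t ≡ᵇ 0) ∨ (v ≡ᵇ suc (asc (take t vs)))

qualifies-fromRuns : ∀ Pre P v → All (λ r → 0 < proj₂ r) (Pre ++ P) →
  qualifies (fromRuns (Pre ++ P)) (totalLength Pre) v ≡ qualifiesAt (values (Pre ++ P)) (length Pre) v
qualifies-fromRuns Pre P v pos = cong₂ _∨_ (start≡0 Pre (All.++⁻ˡ Pre pos)) (cong (λ t → v ≡ᵇ suc t) prefix-asc)
  where
  open ≡-Reasoning
  start≡0 : ∀ Pre → All (λ r → 0 < proj₂ r) Pre → (totalLength Pre ≡ᵇ 0) ≡ (length Pre ≡ᵇ 0)
  start≡0 []                 _ = refl
  start≡0 ((_ , suc _) ∷ _) _ = refl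
  start≡0 ((_ , zero) ∷ _) (() ∷ _)
  prefix-asc : asc (take (totalLength Pre) (fromRuns (Pre ++ P))) ≡ asc (take (length Pre) (values (Pre ++ P)))
  prefix-asc = begin
    asc (take (totalLength Pre) (fromRuns (Pre ++ P)))         ≡⟨ cong₂ (λ t y → asc (take t y)) (sym (length-fromRuns Pre)) (fromRuns-++ Pre P) ⟩
    asc (take (length (fromRuns Pre)) (fromRuns Pre ++ fromRuns P)) ≡⟨ cong asc (take-length-++ (fromRuns Pre) (fromRuns P)) ⟩
    asc (fromRuns Pre)                                         ≡⟨ asc-fromRuns Pre (All.++⁻ˡ Pre pos) ⟩
    asc (values Pre)                                           ≡⟨ cong asc (take-length-++ (values Pre) (values P)) ⟨
    asc (take (length (values Pre)) (values Pre ++ values P))  ≡⟨ cong₂ (λ t y → asc (take t y)) (length-map proj₁ Pre) (sym (map-++ proj₁ Pre P)) ⟩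
    asc (take (length Pre) (values (Pre ++ P)))                ∎

-- Index of the last qualifying run among the runs with values ws, starting from run t,
-- where a is the last qualifying index found so far.
lastQualFrom : List ℕ → ℕ → ℕ → List ℕ → ℕ
lastQualFrom vs t a []       = a
lastQualFrom vs t a (w ∷ ws) = lastQualFrom vs (suc t) (if qualifiesAt vs t w then t else a) ws

lastQualIndex : List ℕ → ℕ
lastQualIndex []       = 0
lastQualIndex (v ∷ ws) = lastQualFrom (v ∷ ws) 1 0 ws

lastQualGo-fromRuns : ∀ R Pre P → R ≡ Pre ++ P → All (λ r → 0 < proj₂ r) R → ∀ a →
  lastQualGo (fromRuns R) (lengthAt a R) (addPos (totalLength Pre) P) ≡
  lengthAt (lastQualFrom (values R) (length Pre) a (values P)) R
lastQualGo-fromRuns R Pre []            R≡ pos a = refl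
lastQualGo-fromRuns R Pre ((v , l) ∷ P) R≡ pos a = begin
  lastQualGo (fromRuns R) (if qualifies (fromRuns R) (totalLength Pre) v then l else lengthAt a R)
    (addPos (totalLength Pre + l) P)
    ≡⟨ cong₂ (λ b L → lastQualGo (fromRuns R) (if b then L else lengthAt a R) (addPos (totalLength Pre + l) P))
             qualifies≡ (sym l≡) ⟩
  lastQualGo (fromRuns R) (if q then lengthAt (length Pre) R else lengthAt a R) (addPos (totalLength Pre + l) P)
    ≡⟨ cong₂ (lastQualGo (fromRuns R)) (if-lengthAt q) (cong (λ s → addPos s P) start≡) ⟩
  lastQualGo (fromRuns R) (lengthAt a′ R) (addPos (totalLength (Pre ∷ʳ (v , l))) P)
    ≡⟨ lastQualGo-fromRuns R (Pre ∷ʳ (v , l)) P (trans R≡ (sym (++-assoc Pre _ P))) pos a′ ⟩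
  lengthAt (lastQualFrom (values R) (length (Pre ∷ʳ (v , l))) a′ (values P)) R
    ≡⟨ cong (λ t → lengthAt (lastQualFrom (values R) t a′ (values P)) R) (trans (length-++ Pre) (+-comm _ 1)) ⟩
  lengthAt (lastQualFrom (values R) (suc (length Pre)) a′ (values P)) R ∎
  where
  open ≡-Reasoning
  q = qualifiesAt (values R) (length Pre) v
  a′ = if q then length Pre else a
  qualifies≡ : qualifies (fromRuns R) (totalLength Pre) v ≡ q
  qualifies≡ = subst (λ R → qualifies (fromRuns R) (totalLength Pre) v ≡ qualifiesAt (values R) (length Pre) v)
                 (sym R≡) (qualifies-fromRuns Pre ((v , l) ∷ P) v (subst (All _) R≡ pos))
  l≡ : lengthAt (length Pre) R ≡ l
  l≡ = trans (cong (lengthAt (length Pre)) R≡) (lengthAt-middle Pre)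
    where
    lengthAt-middle : ∀ Pre → lengthAt (length Pre) (Pre ++ (v , l) ∷ P) ≡ l
    lengthAt-middle []        = refl
    lengthAt-middle (_ ∷ Pre) = lengthAt-middle Pre
  if-lengthAt : ∀ b → (if b then lengthAt (length Pre) R else lengthAt a R) ≡ lengthAt (if b then length Pre else a) R
  if-lengthAt true  = refl
  if-lengthAt false = refl
  start≡ : totalLength Pre + l ≡ totalLength (Pre ∷ʳ (v , l))
  start≡ = sym (trans (totalLength-++ Pre _) (cong (totalLength Pre +_) (+-identityʳ l)))

lastQualRunLen-fromRuns : ∀ R → IsRunList R → lastQualRunLen (fromRuns R) ≡ lengthAt (lastQualIndex (values R)) R
lastQualRunLen-fromRuns []              _  = refl
lastQualRunLen-fromRuns ((v , l) ∷ R′) IR = begin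
  lastQualGo x 0 (addPos 0 (runs x))        ≡⟨ cong (lastQualGo x 0 ∘ addPos 0) (runs-fromRuns _ IR) ⟩
  lastQualGo x l (addPos l R′)              ≡⟨ cong (λ s → lastQualGo x l (addPos s R′)) (sym (+-identityʳ l)) ⟩
  lastQualGo x l (addPos (l + 0) R′)        ≡⟨ lastQualGo-fromRuns _ ((v , l) ∷ []) R′ refl (IsRunList.positive IR) 0 ⟩
  lengthAt (lastQualIndex (values ((v , l) ∷ R′))) ((v , l) ∷ R′) ∎
  where
  open ≡-Reasoning
  x = fromRuns ((v , l) ∷ R′)

lastQualFrom-< : ∀ vs t a ws → a < t → lastQualFrom vs t a ws < t + length ws
lastQualFrom-< vs t a []       a<t = subst (a <_) (sym (+-identityʳ t)) a<t
lastQualFrom-< vs t a (w ∷ ws) a<t = subst (lastQualFrom vs (suc t) (if qualifiesAt vs t w then t else a) ws <_)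
  (sym (+-suc t (length ws)))
  (lastQualFrom-< vs (suc t) _ ws (new<suc (qualifiesAt vs t w)))
  where
  new<suc : ∀ b → (if b then t else a) < suc t
  new<suc true  = ≤-refl
  new<suc false = ≤-trans a<t (n≤1+n t)

lastQualIndex-< : ∀ vs → vs ≢ [] → lastQualIndex vs < length vs
lastQualIndex-< []       vs≢[] = contradiction refl vs≢[]
lastQualIndex-< (v ∷ ws) _     = lastQualFrom-< (v ∷ ws) 1 0 ws (s≤s z≤n)

setLengthAt : ℕ → ℕ → List (ℕ × ℕ) → List (ℕ × ℕ)
setLengthAt j       w []            = []
setLengthAt zero    w ((v , _) ∷ R) = (v , w) ∷ R
setLengthAt (suc j) w (r ∷ R)       = r ∷ setLengthAt j w R

swapLengths : ℕ → List (ℕ × ℕ) → List (ℕ × ℕ)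
swapLengths zero    R             = R
swapLengths (suc j) []            = []
swapLengths (suc j) ((v , l) ∷ R) = (v , lengthAt j R) ∷ setLengthAt j l R

lengthAt-setLengthAt : ∀ j w R → j < length R → lengthAt j (setLengthAt j w R) ≡ w
lengthAt-setLengthAt zero    w (_ ∷ R) _         = refl
lengthAt-setLengthAt (suc j) w (_ ∷ R) (s≤s j<) = lengthAt-setLengthAt j w R j<

setLengthAt-idem : ∀ j w w′ R → setLengthAt j w (setLengthAt j w′ R) ≡ setLengthAt j w R
setLengthAt-idem j       w w′ []      = refl
setLengthAt-idem zero    w w′ (_ ∷ R) = refl
setLengthAt-idem (suc j) w w′ (r ∷ R) = cong (r ∷_) (setLengthAt-idem j w w′ R)

setLengthAt-lengthAt : ∀ j R → setLengthAt j (lengthAt j R) R ≡ R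
setLengthAt-lengthAt j       []      = refl
setLengthAt-lengthAt zero    (_ ∷ R) = refl
setLengthAt-lengthAt (suc j) (r ∷ R) = cong (r ∷_) (setLengthAt-lengthAt j R)

values-setLengthAt : ∀ j w R → values (setLengthAt j w R) ≡ values R
values-setLengthAt j       w []      = refl
values-setLengthAt zero    w (_ ∷ R) = refl
values-setLengthAt (suc j) w (r ∷ R) = cong (proj₁ r ∷_) (values-setLengthAt j w R)

totalLength-setLengthAt : ∀ j w R → j < length R → totalLength (setLengthAt j w R) + lengthAt j R ≡ totalLength R + w
totalLength-setLengthAt zero    w ((_ , l) ∷ R) _         = rearrange w (totalLength R) l
  where
  rearrange : ∀ w t l → (w + t) + l ≡ (l + t) + w
  rearrange = solve-∀
totalLength-setLengthAt (suc j) w ((_ , l) ∷ R) (s≤s j<) =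
  trans (+-assoc l _ _) (trans (cong (l +_) (totalLength-setLengthAt j w R j<)) (sym (+-assoc l _ w)))

positive-setLengthAt : ∀ j {w R} → 0 < w → All (λ r → 0 < proj₂ r) R → All (λ r → 0 < proj₂ r) (setLengthAt j w R)
positive-setLengthAt j       w-pos []           = []
positive-setLengthAt zero    w-pos (_ ∷ pos)    = w-pos ∷ pos
positive-setLengthAt (suc j) w-pos (p ∷ pos)    = p ∷ positive-setLengthAt j w-pos pos

positive-lengthAt : ∀ j {R} → j < length R → All (λ r → 0 < proj₂ r) R → 0 < lengthAt j R
positive-lengthAt zero    _         (p ∷ _)   = p
positive-lengthAt (suc j) (s≤s j<) (_ ∷ pos) = positive-lengthAt j j< pos

InRange : ℕ → List (ℕ × ℕ) → Set
InRange j R = R ≢ [] → j < length R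

values-swapLengths : ∀ j R → values (swapLengths j R) ≡ values R
values-swapLengths zero    R             = refl
values-swapLengths (suc j) []            = refl
values-swapLengths (suc j) ((v , l) ∷ R) = cong (v ∷_) (values-setLengthAt j l R)

lengthAt-0-swapLengths : ∀ j R → lengthAt 0 (swapLengths j R) ≡ lengthAt j R
lengthAt-0-swapLengths zero    R       = refl
lengthAt-0-swapLengths (suc j) []      = refl
lengthAt-0-swapLengths (suc j) (_ ∷ _) = refl

private
  tail-in-range : ∀ {j r R} → InRange (suc j) (r ∷ R) → j < length R
  tail-in-range j∈ with j∈ (λ ())
  ... | s≤s j< = j<

lengthAt-j-swapLengths : ∀ j R → InRange j R → lengthAt j (swapLengths j R) ≡ lengthAt 0 R
lengthAt-j-swapLengths zero    R             _  = refl
lengthAt-j-swapLengths (suc j) []            _  = refl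
lengthAt-j-swapLengths (suc j) ((v , l) ∷ R) j∈ = lengthAt-setLengthAt j l R (tail-in-range j∈)

swapLengths-involutive : ∀ j R → InRange j R → swapLengths j (swapLengths j R) ≡ R
swapLengths-involutive zero    R             _  = refl
swapLengths-involutive (suc j) []            _  = refl
swapLengths-involutive (suc j) ((v , l) ∷ R) j∈ =
  cong₂ (λ l′ R′ → (v , l′) ∷ R′) (lengthAt-setLengthAt j l R (tail-in-range j∈))
        (trans (setLengthAt-idem j _ l R) (setLengthAt-lengthAt j R))

totalLength-swapLengths : ∀ j R → InRange j R → totalLength (swapLengths j R) ≡ totalLength R
totalLength-swapLengths zero    R             _  = refl
totalLength-swapLengths (suc j) []            _  = refl
totalLength-swapLengths (suc j) ((v , l) ∷ R) j∈ =
  trans (+-comm (lengthAt j R) _) (trans (totalLength-setLengthAt j l R (tail-in-range j∈)) (+-comm _ l))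

IsRunList-swapLengths : ∀ j R → InRange j R → IsRunList R → IsRunList (swapLengths j R)
IsRunList-swapLengths j R j∈ IR = record
  { positive    = positive′ j R j∈ (IsRunList.positive IR)
  ; alternating = subst (Linked _≢_) (sym (values-swapLengths j R)) (IsRunList.alternating IR)
  }
  where
  positive′ : ∀ j R → InRange j R → All (λ r → 0 < proj₂ r) R → All (λ r → 0 < proj₂ r) (swapLengths j R)
  positive′ zero    R             _  pos           = pos
  positive′ (suc j) []            _  pos           = pos
  positive′ (suc j) ((v , l) ∷ R) j∈ (l-pos ∷ pos) =
    positive-lengthAt j (tail-in-range j∈) pos ∷ positive-setLengthAt j l-pos pos

record RunLengthStatistic (s : List ℕ → ℕ) : Set where
  field
    runIndex   : List ℕ → ℕ
    runIndex-< : ∀ vs → vs ≢ [] → runIndex vs < length vs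
    s-fromRuns : ∀ R → IsRunList R → s (fromRuns R) ≡ lengthAt (runIndex (values R)) R

AscFibre-≡ : ∀ {n s k} {x y : List ℕ} {x∈ y∈ sx≡ sy≡} → x ≡ y →
  _≡_ {A = AscFibre n s k} ((x , x∈) , sx≡) ((y , y∈) , sy≡)
AscFibre-≡ refl = cong₂ (λ x∈ sx≡ → ((_ , x∈) , sx≡)) (T-irrelevant _ _) (≡-irrelevant _ _)

module RunLengthSwap {s} (S : RunLengthStatistic s) where
  open RunLengthStatistic S

  swapIndex : List ℕ → ℕ
  swapIndex x = runIndex (values (runs x))

  φ : List ℕ → List ℕ
  φ x = fromRuns (swapLengths (swapIndex x) (runs x))

  module _ (x : List ℕ) where
    private
      j = swapIndex x
      R = runs x
      R′ = swapLengths j R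
      IR = IsRunList-runs x

      j∈R : InRange j R
      j∈R R≢[] = subst (j <_) (length-map proj₁ R) (runIndex-< (values R) (R≢[] ∘ values≡[]))
        where
        values≡[] : ∀ {R} → values R ≡ [] → R ≡ []
        values≡[] {[]}    _  = refl
        values≡[] {_ ∷ _} ()

      IR′ = IsRunList-swapLengths j R j∈R IR

      runs-φ : runs (φ x) ≡ R′
      runs-φ = runs-fromRuns R′ IR′

    φ-involutive : φ (φ x) ≡ x
    φ-involutive = trans (cong₂ (λ i R → fromRuns (swapLengths i R)) swapIndex-φ runs-φ)
                         (trans (cong fromRuns (swapLengths-involutive j R j∈R)) (fromRuns-runs x))
      where
      swapIndex-φ : swapIndex (φ x) ≡ j
      swapIndex-φ = cong runIndex (trans (cong values runs-φ) (values-swapLengths j R))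

    isAsc-φ : ∀ n → isAsc n (φ x) ≡ isAsc n x
    isAsc-φ n = begin
      isAsc n (fromRuns R′)                            ≡⟨ isAsc-fromRuns n R′ (IsRunList.positive IR′) ⟩
      (totalLength R′ ≡ᵇ n) ∧ isAscentSeq (values R′)  ≡⟨ cong₂ (λ t vs → (t ≡ᵇ n) ∧ isAscentSeq vs)
                                                             (totalLength-swapLengths j R j∈R) (values-swapLengths j R) ⟩
      (totalLength R ≡ᵇ n) ∧ isAscentSeq (values R)    ≡⟨ isAsc-fromRuns n R (IsRunList.positive IR) ⟨
      isAsc n (fromRuns R)                             ≡⟨ cong (isAsc n) (fromRuns-runs x) ⟩
      isAsc n x                                        ∎
      where open ≡-Reasoning

    firstRunLen∘φ : firstRunLen (φ x) ≡ s x
    firstRunLen∘φ = trans (firstRunLen-fromRuns R′ IR′) (trans (lengthAt-0-swapLengths j R)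
                      (trans (sym (s-fromRuns R IR)) (cong s (fromRuns-runs x))))

    s∘φ : s (φ x) ≡ firstRunLen x
    s∘φ = trans (s-fromRuns R′ IR′) (trans (cong (λ vs → lengthAt (runIndex vs) R′) (values-swapLengths j R))
            (trans (lengthAt-j-swapLengths j R j∈R) (trans (sym (firstRunLen-fromRuns R IR)) (cong firstRunLen (fromRuns-runs x)))))

AscFibre-↔ : ∀ {s} → RunLengthStatistic s → ∀ n k → AscFibre n firstRunLen k ↔ AscFibre n s k
AscFibre-↔ S n k = mk↔ₛ′ (apply s∘φ) (apply firstRunLen∘φ)
                         (λ y → AscFibre-≡ (φ-involutive (proj₁ (proj₁ y))))
                         (λ y → AscFibre-≡ (φ-involutive (proj₁ (proj₁ y))))
  where
  open RunLengthSwap S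
  apply : ∀ {t t′ : List ℕ → ℕ} → (∀ x → t′ (φ x) ≡ t x) → AscFibre n t k → AscFibre n t′ k
  apply e ((x , x∈) , tx≡k) = (φ x , subst T (sym (isAsc-φ x n)) x∈) , trans (e x) tx≡k

lastRunStatistic : RunLengthStatistic lastRunLen
lastRunStatistic = record
  { runIndex   = λ vs → length vs ∸ 1
  ; runIndex-< = λ { [] vs≢[] → contradiction refl vs≢[] ; (_ ∷ vs) _ → ≤-refl }
  ; s-fromRuns = lastRunLen-fromRuns
  }

lastQualRunStatistic : RunLengthStatistic lastQualRunLen
lastQualRunStatistic = record
  { runIndex   = lastQualIndex
  ; runIndex-< = lastQualIndex-<
  ; s-fromRuns = lastQualRunLen-fromRuns
  }

mainTheorem9 : (n : ℕ) → 1 ≤ n →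
    ((m : ℕ) (A : Matrix (suc m)) → T (isInt n A) →
        (entry A Fin.zero Fin.zero ≡ firstRunLen (Γ n A))
      × (val A ≡ lastRunLen (Γ n A))
      × (entry A (lastIx m) (lastIx m) ≡ lastQualRunLen (Γ n A)))
    × ((k : ℕ) → (IntFibre n topLeft k ↔ IntFibre n valS k)
                × (IntFibre n topLeft k ↔ IntFibre n botRight k))
    × ((k : ℕ) → (AscFibre n firstRunLen k ↔ AscFibre n lastRunLen k)
                × (AscFibre n firstRunLen k ↔ AscFibre n lastQualRunLen k))
mainTheorem9 n 1≤n =
    Γ-run-statistics n 1≤n
  , (λ k → IntFibre-↔ (swapCornerVal n) k , IntFibre-↔ (swapCorners n) k)
  , (λ k → AscFibre-↔ lastRunStatistic n k , AscFibre-↔ lastQualRunStatistic n k)
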